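{- Let $H=(V,E)$ be a finite bipartite graph with no isolated vertices. If $H$ is not a star graph, then \[\min_{e\in E(H)}|S_1(e)|\le |E(H)|-\frac{|V(H)|}{2},\] and equality holds if and only if $H$ is isomorphic to one of: $K_{2,2}$; $H_n^1$ for some $n\ge2$; $H_n^2$ for some even $n\ge 2$; $H_n^3$ for some even $n\ge2$; $H_n^4$ for some odd $n\ge3$.
   Context: For an edge $e$ of a graph, $S_1(e)$ denotes the set of edges different from $e$ that share an endpoint with $e$ (so $|S_1(u\sim v)|=d_u+d_v-2$). A star graph is $K_{1,m}$ for some $m\ge1$ (including $K_{1,1}$). The graphs: $H_n^1$ ($n\ge1$) is the disjoint union of $n$ edges (a perfect matching on $2n$ vertices). $H_n^2$ ($n$ even) is the disjoint union of two copies of $K_{1,n/2}$, with bipartition in which both centers lie in one part (sizes $2$ and $n$). $H_n^3$ ($n$ even) is the disjoint union of two copies of $K_{1,n/2}$, with bipartition in which one center lies in each part (both parts of size $n/2+1$). $H_n^4$ ($n$ odd, $n\ge3$), with $k=\frac{n+1}{2}$, has bipartition $A=\{u_1,\dots,u_k\}$, $B=\{v_1,\dots,v_k\}$ and edge set $\{u_1v_j:1\le j\le k\}\cup\{u_iv_k:1\le i\le k\}$ (a tree with $n$ edges). -}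

module Defs where

open import Data.Nat using (ℕ; zero; suc; _+_; _*_; _∸_; _⊓_; _≡ᵇ_; _<ᵇ_)
open import Data.Nat.DivMod using (_/_)
open import Data.Bool using (Bool; true; false; _∧_; _∨_; not; if_then_else_)
open import Data.Bool.Properties using (∨-comm)
open import Data.Fin using (Fin; toℕ; _≟_)
open import Data.Bool.ListAction using (any)
open import Data.List using (List; []; _∷_; length; filterᵇ; concatMap; allFin; foldr; upTo; map; _++_)
open import Data.Product using (_×_; _,_; ∃)
open import Relation.Binary.PropositionalEquality using (_≡_; refl; cong; cong₂)
open import Relation.Nullary.Decidable using (⌊_⌋)
open import Function.Bundles using (_↔_; Inverse)

record Graph : Set where
  field
    n      : ℕ
    adj    : Fin n → Fin n → Bool
    sym    : ∀ i j → adj i j ≡ adj j i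
    irrefl : ∀ i → adj i i ≡ false

open Graph public

-- Edge set: each edge {i,j} listed once as (i , j) with toℕ i < toℕ j.
Edge : Graph → Set
Edge G = Fin (n G) × Fin (n G)

edges : (G : Graph) → List (Edge G)
edges G = concatMap (λ i → concatMap (λ j →
            if adj G i j ∧ (toℕ i <ᵇ toℕ j) then (i , j) ∷ [] else [])
              (allFin (n G))) (allFin (n G))

numEdges : Graph → ℕ
numEdges G = length (edges G)

numVertices : Graph → ℕ
numVertices G = n G

_==_ : ∀ {m} → Fin m → Fin m → Bool
a == b = ⌊ a ≟ b ⌋

sameEdge : ∀ {m} → Fin m × Fin m → Fin m × Fin m → Bool
sameEdge (a , b) (c , d) = (a == c) ∧ (b == d)

shareEnd : ∀ {m} → Fin m × Fin m → Fin m × Fin m → Bool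
shareEnd (a , b) (c , d) = (a == c) ∨ (a == d) ∨ (b == c) ∨ (b == d)

S1 : (G : Graph) → Edge G → List (Edge G)
S1 G e = filterᵇ (λ f → not (sameEdge f e) ∧ shareEnd f e) (edges G)

-- minimum of a list of naturals (only used on non-empty lists; [] ↦ 0)
minList : List ℕ → ℕ
minList []       = 0
minList (x ∷ xs) = foldr _⊓_ x xs

minS1 : Graph → ℕ
minS1 G = minList (map (λ e → length (S1 G e)) (edges G))

IsBipartite : Graph → Set
IsBipartite G = ∃ λ (c : Fin (n G) → Bool) →
  ∀ i j → adj G i j ≡ true → (c i ≡ c j → Data.Empty.⊥)
  where import Data.Empty

NoIsolated : Graph → Set
NoIsolated G = ∀ i → ∃ λ j → adj G i j ≡ true

record _≅_ (G H : Graph) : Set where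
  field
    bij      : Fin (n G) ↔ Fin (n H)
    preserve : ∀ i j → adj G i j ≡ adj H (Inverse.to bij i) (Inverse.to bij j)

private
  ≡ᵇ-sym : ∀ a b → (a ≡ᵇ b) ≡ (b ≡ᵇ a)
  ≡ᵇ-sym zero zero = refl
  ≡ᵇ-sym zero (suc b) = refl
  ≡ᵇ-sym (suc a) zero = refl
  ≡ᵇ-sym (suc a) (suc b) = ≡ᵇ-sym a b

  ≡ᵇ-refl : ∀ a → (a ≡ᵇ a) ≡ true
  ≡ᵇ-refl zero = refl
  ≡ᵇ-refl (suc a) = ≡ᵇ-refl a

hit : ℕ → ℕ → ℕ × ℕ → Bool
hit x y (a , b) = ((a ≡ᵇ x) ∧ (b ≡ᵇ y)) ∨ ((a ≡ᵇ y) ∧ (b ≡ᵇ x))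

private
  any-hit-sym : ∀ x y es → any (hit x y) es ≡ any (hit y x) es
  any-hit-sym x y [] = refl
  any-hit-sym x y ((a , b) ∷ es) =
    cong₂ _∨_ (∨-comm ((a ≡ᵇ x) ∧ (b ≡ᵇ y)) ((a ≡ᵇ y) ∧ (b ≡ᵇ x)))
              (any-hit-sym x y es)

fromEdges : (N : ℕ) → List (ℕ × ℕ) → Graph
fromEdges N es = record
  { n      = N
  ; adj    = λ i j → not (toℕ i ≡ᵇ toℕ j) ∧ any (hit (toℕ i) (toℕ j)) es
  ; sym    = λ i j → cong₂ (λ u v → not u ∧ v) (≡ᵇ-sym (toℕ i) (toℕ j))
                       (any-hit-sym (toℕ i) (toℕ j) es)
  ; irrefl = λ i → cong (λ u → not u ∧ any (hit (toℕ i) (toℕ i)) es) (≡ᵇ-refl (toℕ i))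
  }

star : ℕ → Graph
star m = fromEdges (suc m) (map (λ j → (0 , suc j)) (upTo m))

IsStar : Graph → Set
IsStar G = ∃ λ m → (1 Data.Nat.≤ m) × (G ≅ star m)
  where import Data.Nat

K22 : Graph
K22 = fromEdges 4 ((0 , 2) ∷ (0 , 3) ∷ (1 , 2) ∷ (1 , 3) ∷ [])

H1 : ℕ → Graph
H1 m = fromEdges (2 * m) (map (λ i → (2 * i , suc (2 * i))) (upTo m))

twoStars : ℕ → Graph
twoStars k = fromEdges (2 * k + 2)
  (map (λ j → (0 , suc j)) (upTo k) ++ map (λ j → (suc k , k + 2 + j)) (upTo k))

-- H_n^2 and H_n^3 (n even) are both, as graphs, the disjoint union of two
-- copies of K_{1,n/2}; they differ only in the chosen bipartition.
H2 : ℕ → Graph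
H2 m = twoStars (m / 2)

H3 : ℕ → Graph
H3 m = twoStars (m / 2)

-- H_n^4 (n odd), k = (n+1)/2: u_i ↦ i-1 (labels 0..k-1), v_j ↦ k+j-1
-- (labels k..2k-1); edges u_1 v_j (all j) and u_i v_k (all i).
H4tree : ℕ → Graph
H4tree k = fromEdges (2 * k)
  (map (λ j → (0 , k + j)) (upTo k) ++ map (λ i → (i , k + k ∸ 1)) (upTo k))

H4 : ℕ → Graph
H4 m = H4tree ((m + 1) / 2)

{-# OPTIONS --safe #-}
-- Let uv be an edge minimising d u + d v = |S₁(uv)| + 2, with d u = 1 + a and d v = 1 + b.  By the
-- handshake lemma the inequality says that the excess Σᵢ (d i − 1) is at least 2(a + b).  If a, b ≥ 1,
-- u and v contribute a + b, and by minimality each of the a other neighbours of u has excess at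
-- least b and each of the b other neighbours of v excess at least a; the two sets are disjoint since
-- a bipartite graph has no triangles, and ab + ba ≥ a + b.  If a = 0 < b, as G is not a star some
-- edge xy avoids v, and minimality gives excess at least b at x and y.  Equality makes every estimate tight, which leaves K₂,₂, a perfect matching, two disjoint
-- stars of equal size or the double star H⁴.  Conversely each of these graphs is a blow-up of a small
-- pattern (or a perfect matching), so its degrees, and with them minS1 and the number of edges, are
-- read off class by class; all of these are isomorphism invariants.

module Submission where

open import Defs renaming (sym to adj-sym)
open import Data.Nat using (ℕ; zero; suc; pred; >-nonZero; _+_; _*_; _∸_; _⊓_; _≤_; _<_; _≤?_; z≤n; s≤s; z<s; s<s; _<ᵇ_; _≡ᵇ_)
open import Data.Nat.Properties hiding (_≟_)
open import Data.Bool using (Bool; true; false; _∧_; _∨_; not; if_then_else_; T)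
open import Data.Bool.ListAction using (any)
import Data.Bool.Properties as Bool
open import Data.Bool.Properties using (∧-zeroʳ; ∧-identityʳ; ∨-zeroʳ; ∨-identityʳ; T-≡; T-∧; T-∨)
open import Data.Fin using (Fin; toℕ; fromℕ<; _≟_; punchIn) renaming (zero to fz; suc to fs)
open import Data.Fin.Patterns using (0F; 1F; 2F; 3F)
open import Data.Fin.Properties using (toℕ-injective; toℕ<n; toℕ-fromℕ<; all?; any?) renaming (suc-injective to fs-injective)
open import Data.Product using (_×_; _,_; ∃; proj₁; proj₂)
open import Data.Sum using (_⊎_; inj₁; inj₂)
import Data.Sum as Sum
open import Data.Empty using (⊥; ⊥-elim)
open import Data.Unit using (tt)
open import Relation.Nullary using (¬_; yes; no; Dec; ¬?; _×-dec_)
open import Relation.Binary.PropositionalEquality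
  using (_≡_; _≢_; refl; sym; trans; cong; cong₂; subst; subst₂; module ≡-Reasoning)
open import Function using (_∘_; id; Equivalence; _⇔_; mk⇔)
open import Data.Fin.Permutation using (Permutation; _⟨$⟩ʳ_; _⟨$⟩ˡ_; inverseˡ; inverseʳ; ↔⇒≡)
import Data.Fin.Permutation as Perm
open import Data.List using (List; []; _∷_; _++_; length; filterᵇ; concatMap; tabulate; allFin; map; foldr; upTo)
open import Data.List.Membership.Propositional using (_∈_)
open import Data.List.Membership.Propositional.Properties
  using (∈-concatMap⁺; ∈-concatMap⁻; ∈-map⁺; ∈-map⁻; ∈-++⁺ˡ; ∈-++⁺ʳ; ∈-++⁻; ∈-upTo⁺; ∈-upTo⁻)
open import Data.List.Relation.Unary.Any using (here; there)
open import Data.List.Relation.Unary.Any.Properties using (tabulate⁺; tabulate⁻)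
open import Data.List.Properties using (filter-++; length-++; filter-all)
open import Data.List.Relation.Unary.All using (universal)
open import Relation.Binary.Definitions using (tri<; tri≈; tri>)
open import Relation.Nullary.Decidable using (T?; from-yes; decidable-stable)
open import Data.Nat.Tactic.RingSolver using (solve-∀)
open import Data.Nat.DivMod using (_/_; m*n/n≡m; /-monoˡ-≤)
open import Data.Nat.Divisibility using (_∣_; divides; m∣m*n; ∣m+n∣m⇒∣n; ∣1⇒≡1)
open import Algebra.Properties.Semiring.Sum +-*-semiring
  using (sum; sum-cong-≗; ∑-distrib-+; ∑-comm; ∑-permute; *-distribˡ-sum; *-distribʳ-sum; sum-remove)

[_] : Bool → ℕ
[ true ]  = 1
[ false ] = 0

bool-ext : ∀ {a b : Bool} → (a ≡ true → b ≡ true) → (b ≡ true → a ≡ true) → a ≡ b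
bool-ext {false} {false} _ _ = refl
bool-ext {false} {true}  _ g with () ← g refl
bool-ext {true}  {false} f _ with () ← f refl
bool-ext {true}  {true}  _ _ = refl

∧-false : ∀ {x y : Bool} → (x ≡ true → y ≡ true → ⊥) → x ∧ y ≡ false
∧-false {false}         _ = refl
∧-false {true}  {false} _ = refl
∧-false {true}  {true}  f = ⊥-elim (f refl refl)

false≢true : false ≢ true
false≢true ()

¬true⇒false : ∀ {x : Bool} → ¬ x ≡ true → x ≡ false
¬true⇒false {false} _ = refl
¬true⇒false {true}  f = ⊥-elim (f refl)

∧-true : ∀ {x y : Bool} → x ∧ y ≡ true → x ≡ true × y ≡ true
∧-true {true} {true} _ = refl , refl

∨-true : ∀ {x y : Bool} → x ∨ y ≡ true → x ≡ true ⊎ y ≡ true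
∨-true {true}         _ = inj₁ refl
∨-true {false} {true} _ = inj₂ refl

<⇒<ᵇ≡true : ∀ {m n} → m < n → (m <ᵇ n) ≡ true
<⇒<ᵇ≡true m<n = Equivalence.to T-≡ (<⇒<ᵇ m<n)

≤⇒<ᵇ≡false : ∀ {m n} → n ≤ m → (m <ᵇ n) ≡ false
≤⇒<ᵇ≡false {m} {n} n≤m = ¬true⇒false (λ e → <⇒≱ (<ᵇ⇒< m n (Equivalence.from T-≡ e)) n≤m)

≡ᵇ⇒≡-true : ∀ {a b} → (a ≡ᵇ b) ≡ true → a ≡ b
≡ᵇ⇒≡-true {a} {b} e = ≡ᵇ⇒≡ a b (Equivalence.from T-≡ e)

≡⇒≡ᵇ-true : ∀ {a b} → a ≡ b → (a ≡ᵇ b) ≡ true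
≡⇒≡ᵇ-true {a} {b} e = Equivalence.to T-≡ (≡⇒≡ᵇ a b e)

≢⇒≡ᵇ-false : ∀ {a b} → a ≢ b → (a ≡ᵇ b) ≡ false
≢⇒≡ᵇ-false a≢b = ¬true⇒false (a≢b ∘ ≡ᵇ⇒≡-true)

==-refl : ∀ {m} (a : Fin m) → (a == a) ≡ true
==-refl a with a ≟ a
... | yes _  = refl
... | no a≢a = ⊥-elim (a≢a refl)

==⇒≡ : ∀ {m} {a b : Fin m} → (a == b) ≡ true → a ≡ b
==⇒≡ {a = a} {b} e with a ≟ b
... | yes a≡b = a≡b

≢⇒==false : ∀ {m} {a b : Fin m} → a ≢ b → (a == b) ≡ false
≢⇒==false a≢b = ¬true⇒false (a≢b ∘ ==⇒≡)

==false⇒≢ : ∀ {m} {a b : Fin m} → (a == b) ≡ false → a ≢ b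
==false⇒≢ {a = a} e refl with () ← trans (sym e) (==-refl a)

==-sym : ∀ {m} (a b : Fin m) → (a == b) ≡ (b == a)
==-sym a b = bool-ext (λ e → subst (λ x → (x == a) ≡ true) (==⇒≡ e) (==-refl a))
                      (λ e → subst (λ x → (x == b) ≡ true) (==⇒≡ e) (==-refl b))

==-injective : ∀ {m k} (f : Fin m → Fin k) → (∀ {i j} → f i ≡ f j → i ≡ j) → ∀ i j → (f i == f j) ≡ (i == j)
==-injective f f-inj i j = bool-ext (λ e → subst (λ x → (i == x) ≡ true) (f-inj (==⇒≡ e)) (==-refl i))
                                    (λ e → subst (λ x → (f i == f x) ≡ true) (==⇒≡ e) (==-refl (f i)))

fs-== : ∀ {m} (a b : Fin m) → (fs a == fs b) ≡ (a == b)
fs-== = ==-injective fs fs-injective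

count : ∀ {n} → (Fin n → Bool) → ℕ
count p = sum (λ i → [ p i ])

sum-mono-≤ : ∀ {n} {f g : Fin n → ℕ} → (∀ i → f i ≤ g i) → sum f ≤ sum g
sum-mono-≤ {zero}  f≤g = z≤n
sum-mono-≤ {suc n} f≤g = +-mono-≤ (f≤g fz) (sum-mono-≤ (f≤g ∘ fs))

sum-mono-≤-tight : ∀ {n} {f g : Fin n → ℕ} → (∀ i → f i ≤ g i) → sum g ≤ sum f → ∀ i → f i ≡ g i
sum-mono-≤-tight {suc n} {f} {g} f≤g Σg≤Σf fz =
  ≤-antisym (f≤g fz) (+-cancelʳ-≤ _ _ _ (≤-trans (+-monoʳ-≤ (g fz) (sum-mono-≤ (f≤g ∘ fs))) Σg≤Σf))
sum-mono-≤-tight {suc n} {f} {g} f≤g Σg≤Σf (fs i) =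
  sum-mono-≤-tight (f≤g ∘ fs) (+-cancelˡ-≤ (g fz) _ _ (≤-trans Σg≤Σf (+-monoˡ-≤ _ (f≤g fz)))) i

≤-sum : ∀ {n} (f : Fin n → ℕ) i → f i ≤ sum f
≤-sum f fz     = m≤m+n _ _
≤-sum f (fs i) = ≤-trans (≤-sum (f ∘ fs) i) (m≤n+m _ (f fz))

sum-const : ∀ n c → sum {n} (λ _ → c) ≡ n * c
sum-const zero    c = refl
sum-const (suc n) c = cong (c +_) (sum-const n c)

count-true : ∀ n → count {n} (λ _ → true) ≡ n
count-true n = trans (sum-const n 1) (*-identityʳ n)

sum-delta : ∀ {n} (a : Fin n) (f : Fin n → ℕ) → sum (λ i → [ i == a ] * f i) ≡ f a
sum-delta {suc n} fz f = begin
  f fz + 0 + sum {n} (λ _ → 0) ≡⟨ cong (f fz + 0 +_) (trans (sum-const n 0) (*-zeroʳ n)) ⟩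
  f fz + 0 + 0                 ≡⟨ trans (+-identityʳ _) (+-identityʳ _) ⟩
  f fz                         ∎
  where open ≡-Reasoning
sum-delta (fs a) f = trans (sum-cong-≗ (λ i → cong (λ b → [ b ] * f (fs i)) (fs-== i a))) (sum-delta a (f ∘ fs))

count-singleton : ∀ {n} (a : Fin n) → count (_== a) ≡ 1
count-singleton a = trans (sum-cong-≗ (λ i → sym (*-identityʳ [ i == a ]))) (sum-delta a (λ _ → 1))

count-split : ∀ {n} (p q : Fin n → Bool) → count p ≡ count (λ i → p i ∧ q i) + count (λ i → p i ∧ not (q i))
count-split p q = trans (sum-cong-≗ split) (∑-distrib-+ (λ i → [ p i ∧ q i ]) (λ i → [ p i ∧ not (q i) ]))
  where
  split : ∀ i → [ p i ] ≡ [ p i ∧ q i ] + [ p i ∧ not (q i) ]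
  split i with p i | q i
  ... | true  | true  = refl
  ... | true  | false = refl
  ... | false | _     = refl

count-remove : ∀ {n} (p : Fin n → Bool) (a : Fin n) → p a ≡ true →
               count p ≡ suc (count (λ i → p i ∧ not (i == a)))
count-remove p a pa =
  trans (count-split p (_== a)) (cong (_+ count (λ i → p i ∧ not (i == a))) (trans (sum-cong-≗ at-a) (count-singleton a)))
  where
  at-a : ∀ i → [ p i ∧ (i == a) ] ≡ [ i == a ]
  at-a i with i == a in e
  ... | false = cong [_] (∧-zeroʳ (p i))
  ... | true rewrite ==⇒≡ e | pa = refl

1≤count : ∀ {n} (p : Fin n → Bool) {a} → p a ≡ true → 1 ≤ count p
1≤count p {a} pa = subst (_≤ count p) (cong [_] pa) (≤-sum (λ i → [ p i ]) a)

1≤count⇒∃ : ∀ {n} (p : Fin n → Bool) → 1 ≤ count p → ∃ λ i → p i ≡ true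
1≤count⇒∃ {suc n} p 1≤c with p fz in e
... | true  = fz , e
... | false = let i , pi = 1≤count⇒∃ (p ∘ fs) 1≤c in fs i , pi

2≤count : ∀ {n} (p : Fin n → Bool) {a b} → p a ≡ true → p b ≡ true → a ≢ b → 2 ≤ count p
2≤count p {a} {b} pa pb a≢b = subst (2 ≤_) (sym (count-remove p a pa))
  (s≤s (subst (_≤ _) (cong [_] pb′) (≤-sum (λ i → [ p i ∧ not (i == a) ]) b)))
  where
  pb′ : p b ∧ not (b == a) ≡ true
  pb′ rewrite pb | ≢⇒==false (a≢b ∘ sym) = refl

3≤count : ∀ {n} (p : Fin n → Bool) {a b c} → p a ≡ true → p b ≡ true → p c ≡ true →
          a ≢ b → a ≢ c → b ≢ c → 3 ≤ count p
3≤count p {a} {b} {c} pa pb pc a≢b a≢c b≢c = subst (3 ≤_) (sym (count-remove p a pa))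
  (s≤s (2≤count (λ i → p i ∧ not (i == a)) (other pb (a≢b ∘ sym)) (other pc (a≢c ∘ sym)) b≢c))
  where
  other : ∀ {x} → p x ≡ true → x ≢ a → p x ∧ not (x == a) ≡ true
  other px x≢a rewrite px | ≢⇒==false x≢a = refl

sum-if : ∀ {n} (p : Fin n → Bool) (c : ℕ) → sum (λ i → if p i then c else 0) ≡ count p * c
sum-if p c = trans (sum-cong-≗ ite) (sym (*-distribʳ-sum c (λ i → [ p i ])))
  where
  ite : ∀ i → (if p i then c else 0) ≡ [ p i ] * c
  ite i with p i
  ... | true  = sym (+-identityʳ c)
  ... | false = refl

sum-if-== : ∀ {n} (a : Fin n) c → sum (λ i → if i == a then c else 0) ≡ c
sum-if-== a c = trans (sum-if (_== a) c) (trans (cong (_* c) (count-singleton a)) (*-identityˡ c))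

m+n≡o⇒o≤n⇒m≡0 : ∀ {m n o} → m + n ≡ o → o ≤ n → m ≡ 0
m+n≡o⇒o≤n⇒m≡0 {m} {n} e o≤n = n≤0⇒n≡0 (+-cancelʳ-≤ n m 0 (subst (_≤ n) (sym e) o≤n))

+-tight : ∀ {x y p q} → p ≤ x → q ≤ y → x + y ≤ p + q → x ≡ p × y ≡ q
+-tight {x} {y} {p} {q} p≤x q≤y x+y≤p+q =
  ≤-antisym (+-cancelʳ-≤ y x p (≤-trans x+y≤p+q (+-monoʳ-≤ p q≤y))) p≤x ,
  ≤-antisym (+-cancelˡ-≤ x y q (≤-trans x+y≤p+q (+-monoˡ-≤ q p≤x))) q≤y

ab+ba≤a+b⇒≡1 : ∀ {a b} → 1 ≤ a → 1 ≤ b → a * b + b * a ≤ a + b → a ≡ 1 × b ≡ 1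
ab+ba≤a+b⇒≡1 {suc a} {suc b} _ _ h with +-tight (m≤m*n (suc a) (suc b)) (m≤m*n (suc b) (suc a)) h
... | ab≡a , ba≡b = *-cancelˡ-≡ (suc a) 1 (suc b) (trans ba≡b (sym (*-identityʳ (suc b)))) ,
                    *-cancelˡ-≡ (suc b) 1 (suc a) (trans ab≡a (sym (*-identityʳ (suc a))))

-- Degrees, the handshake lemma and |S₁(e)|

deg : (G : Graph) → Fin (n G) → ℕ
deg G i = count (adj G i)

-- edges G lists exactly the pairs (a , b) with adj< G a b
adj< : (G : Graph) → Fin (n G) → Fin (n G) → Bool
adj< G a b = adj G a b ∧ (toℕ a <ᵇ toℕ b)

length-filterᵇ-++ : ∀ {A : Set} (p : A → Bool) xs ys →
                    length (filterᵇ p (xs ++ ys)) ≡ length (filterᵇ p xs) + length (filterᵇ p ys)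
length-filterᵇ-++ p xs ys = trans (cong length (filter-++ (T? ∘ p) xs ys)) (length-++ (filterᵇ p xs))

length-filterᵇ-concatMap : ∀ {A B : Set} {k} (p : A → Bool) (f : B → List A) (g : Fin k → B) →
  length (filterᵇ p (concatMap f (tabulate g))) ≡ sum (λ i → length (filterᵇ p (f (g i))))
length-filterᵇ-concatMap {k = zero}  p f g = refl
length-filterᵇ-concatMap {k = suc k} p f g =
  trans (length-filterᵇ-++ p (f (g fz)) _) (cong (_ +_) (length-filterᵇ-concatMap p f (g ∘ fs)))

length-filterᵇ-singleton : ∀ {A : Set} (p : A → Bool) c (x : A) →
                           length (filterᵇ p (if c then x ∷ [] else [])) ≡ [ c ∧ p x ]
length-filterᵇ-singleton p false x = refl
length-filterᵇ-singleton p true  x with p x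
... | true  = refl
... | false = refl

length-filterᵇ-edges : (G : Graph) (p : Edge G → Bool) →
  length (filterᵇ p (edges G)) ≡ sum (λ a → sum (λ b → [ adj< G a b ∧ p (a , b) ]))
length-filterᵇ-edges G p =
  trans (length-filterᵇ-concatMap p row id)
        (sum-cong-≗ λ a → trans (length-filterᵇ-concatMap p (λ b → if adj< G a b then (a , b) ∷ [] else []) id)
                                (sum-cong-≗ λ b → length-filterᵇ-singleton p (adj< G a b) (a , b)))
  where
  row : Fin (n G) → List (Edge G)
  row a = concatMap (λ b → if adj< G a b then (a , b) ∷ [] else []) (allFin (n G))

adj-split : (G : Graph) (a b : Fin (n G)) → [ adj< G a b ] + [ adj< G b a ] ≡ [ adj G a b ]
adj-split G a b with <-cmp (toℕ a) (toℕ b)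
... | tri< a<b _ _ rewrite <⇒<ᵇ≡true a<b | ≤⇒<ᵇ≡false (<⇒≤ a<b)
                         | ∧-identityʳ (adj G a b) | ∧-zeroʳ (adj G b a) = +-identityʳ _
... | tri> _ _ b<a rewrite <⇒<ᵇ≡true b<a | ≤⇒<ᵇ≡false (<⇒≤ b<a)
                         | ∧-identityʳ (adj G b a) | ∧-zeroʳ (adj G a b) = cong [_] (adj-sym G b a)
... | tri≈ _ a≡b _ rewrite toℕ-injective a≡b | irrefl G b = refl

sum₂ : ∀ {m} → (Fin m → Fin m → ℕ) → ℕ
sum₂ f = sum (λ a → sum (f a))

sum₂-distrib-+ : ∀ {m} (f g : Fin m → Fin m → ℕ) → sum₂ (λ a b → f a b + g a b) ≡ sum₂ f + sum₂ g
sum₂-distrib-+ f g = trans (sum-cong-≗ (λ a → ∑-distrib-+ (f a) (g a))) (∑-distrib-+ (λ a → sum (f a)) (λ a → sum (g a)))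

deg-split : (G : Graph) (x : Fin (n G)) → deg G x ≡ sum (λ b → [ adj< G x b ]) + sum (λ a → [ adj< G a x ])
deg-split G x = trans (sym (sum-cong-≗ {n G} (adj-split G x))) (∑-distrib-+ (λ b → [ adj< G x b ]) (λ a → [ adj< G a x ]))

numEdges≡sum₂ : (G : Graph) → numEdges G ≡ sum₂ (λ a b → [ adj< G a b ])
numEdges≡sum₂ G = begin
  length (edges G)                                   ≡⟨ cong length (filter-all (T? ∘ λ _ → true) (universal (λ _ → tt) (edges G))) ⟨
  length (filterᵇ (λ _ → true) (edges G))            ≡⟨ length-filterᵇ-edges G (λ _ → true) ⟩
  sum₂ (λ a b → [ adj< G a b ∧ true ])               ≡⟨ sum-cong-≗ {n G} (λ a → sum-cong-≗ {n G} (λ b → cong [_] (∧-identityʳ _))) ⟩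
  sum₂ (λ a b → [ adj< G a b ])                      ∎
  where open ≡-Reasoning

handshake : (G : Graph) → 2 * numEdges G ≡ sum (deg G)
handshake G = begin
  2 * numEdges G                                              ≡⟨ cong (2 *_) (numEdges≡sum₂ G) ⟩
  2 * sum₂ E                                                  ≡⟨ cong (sum₂ E +_) (+-identityʳ _) ⟩
  sum₂ E + sum₂ E                                             ≡⟨ cong (sum₂ E +_) (∑-comm E) ⟩
  sum₂ E + sum (λ x → sum (λ a → E a x))                      ≡⟨ ∑-distrib-+ (λ x → sum (E x)) (λ x → sum (λ a → E a x)) ⟨
  sum (λ x → sum (E x) + sum (λ a → E a x))                   ≡⟨ sum-cong-≗ (deg-split G) ⟨
  sum (deg G)                                                 ∎
  where
  open ≡-Reasoning
  E : Fin (n G) → Fin (n G) → ℕ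
  E a b = [ adj< G a b ]

adj<⇒adj : (G : Graph) {a b : Fin (n G)} → adj< G a b ≡ true → adj G a b ≡ true
adj<⇒adj G = proj₁ ∘ ∧-true

adj<⇒< : (G : Graph) {a b : Fin (n G)} → adj< G a b ≡ true → toℕ a < toℕ b
adj<⇒< G {a} {b} e = <ᵇ⇒< (toℕ a) (toℕ b) (Equivalence.from T-≡ (proj₂ (∧-true e)))

adj<-irrefl : (G : Graph) (a : Fin (n G)) → adj< G a a ≡ false
adj<-irrefl G a rewrite irrefl G a = refl

==-exclusiveʳ : ∀ {m} {b c : Fin m} (a : Fin m) → b ≢ c → (a == b) ∧ (a == c) ≡ false
==-exclusiveʳ a b≢c = ∧-false {a == _} λ p q → b≢c (trans (sym (==⇒≡ p)) (==⇒≡ q))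

==-exclusiveˡ : ∀ {m} {a b : Fin m} (c : Fin m) → a ≢ b → (a == c) ∧ (b == c) ≡ false
==-exclusiveˡ c a≢b = ∧-false {_ == c} λ p q → a≢b (trans (==⇒≡ p) (sym (==⇒≡ q)))

-- For a listed edge (a , b), x₁ … x₄ say whether a = i, a = j, b = i, b = j: an edge of S₁(ij) meets
-- ij once, and ij itself is counted at both of its ends.
incidence-table : ∀ x₁ x₂ x₃ x₄ →
  x₁ ∧ x₂ ≡ false → x₃ ∧ x₄ ≡ false → x₁ ∧ x₃ ≡ false → x₂ ∧ x₄ ≡ false → x₂ ∧ x₃ ≡ false →
  [ not (x₁ ∧ x₄) ∧ (x₁ ∨ x₂ ∨ x₃ ∨ x₄) ] + 2 * [ x₁ ∧ x₄ ] ≡ [ x₁ ∨ x₃ ] + [ x₂ ∨ x₄ ]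
incidence-table true  true  _     _     () _  _  _  _
incidence-table true  false true  _     _  _  () _  _
incidence-table true  false false true  _  _  _  _  _  = refl
incidence-table true  false false false _  _  _  _  _  = refl
incidence-table false true  true  _     _  _  _  _  ()
incidence-table false true  false true  _  _  _  () _
incidence-table false true  false false _  _  _  _  _  = refl
incidence-table false false true  true  _  () _  _  _
incidence-table false false true  false _  _  _  _  _  = refl
incidence-table false false false true  _  _  _  _  _  = refl
incidence-table false false false false _  _  _  _  _  = refl

incident : (G : Graph) → Fin (n G) → Fin (n G) → Fin (n G) → ℕ
incident G x a b = [ adj< G a b ∧ ((a == x) ∨ (b == x)) ]

incident-count : (G : Graph) (x : Fin (n G)) → sum₂ (incident G x) ≡ deg G x
incident-count G x = begin
  sum₂ (incident G x)
    ≡⟨ sum-cong-≗ {n G} (λ a → sum-cong-≗ {n G} (pointwise a)) ⟩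
  sum₂ (λ a b → [ a == x ] * [ adj< G x b ] + [ b == x ] * [ adj< G a x ])
    ≡⟨ sum₂-distrib-+ (λ a b → [ a == x ] * [ adj< G x b ]) (λ a b → [ b == x ] * [ adj< G a x ]) ⟩
  sum₂ (λ a b → [ a == x ] * [ adj< G x b ]) + sum₂ (λ a b → [ b == x ] * [ adj< G a x ])
    ≡⟨ cong₂ _+_ (trans (sum-cong-≗ {n G} (λ a → sym (*-distribˡ-sum [ a == x ] (λ b → [ adj< G x b ]))))
                        (sum-delta x (λ _ → sum (λ b → [ adj< G x b ]))))
                 (sum-cong-≗ {n G} (λ a → sum-delta x (λ _ → [ adj< G a x ]))) ⟩
  sum (λ b → [ adj< G x b ]) + sum (λ a → [ adj< G a x ])
    ≡⟨ deg-split G x ⟨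
  deg G x ∎
  where
  open ≡-Reasoning
  pointwise : ∀ a b → incident G x a b ≡ [ a == x ] * [ adj< G x b ] + [ b == x ] * [ adj< G a x ]
  pointwise a b with a == x in ax | b == x in bx
  ... | true  | true  rewrite ==⇒≡ ax | ==⇒≡ bx | adj<-irrefl G x = refl
  ... | true  | false rewrite ==⇒≡ ax | ∧-identityʳ (adj< G x b) = sym (trans (+-identityʳ _) (+-identityʳ _))
  ... | false | true  rewrite ==⇒≡ bx | ∧-identityʳ (adj< G a x) = sym (+-identityʳ _)
  ... | false | false rewrite ∧-zeroʳ (adj< G a b) = refl

module _ (G : Graph) {i j : Fin (n G)} (ij : adj< G i j ≡ true) where

  private
    inS1 same : Fin (n G) → Fin (n G) → ℕ
    inS1 a b = [ adj< G a b ∧ (not ((a == i) ∧ (b == j)) ∧ ((a == i) ∨ (a == j) ∨ (b == i) ∨ (b == j))) ]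
    same a b = [ adj< G a b ∧ ((a == i) ∧ (b == j)) ]

    i≢j : i ≢ j
    i≢j refl = <-irrefl refl (adj<⇒< G ij)

    S1-pointwise : ∀ a b → inS1 a b + 2 * same a b ≡ incident G i a b + incident G j a b
    S1-pointwise a b with adj< G a b in ab
    ... | false = refl
    ... | true  = incidence-table (a == i) (a == j) (b == i) (b == j)
      (==-exclusiveʳ a i≢j) (==-exclusiveʳ b i≢j) (==-exclusiveˡ i a≢b) (==-exclusiveˡ j a≢b)
      (∧-false {a == j} λ aj bi → <-asym (adj<⇒< G ij)
        (subst₂ (λ x y → toℕ x < toℕ y) (==⇒≡ aj) (==⇒≡ bi) (adj<⇒< G ab)))
      where
      a≢b : a ≢ b
      a≢b refl = <-irrefl refl (adj<⇒< G ab)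

    same-pointwise : ∀ a b → same a b ≡ [ a == i ] * [ b == j ]
    same-pointwise a b with a == i in ai | b == j in bj
    ... | true  | true  rewrite ==⇒≡ ai | ==⇒≡ bj | ij = refl
    ... | true  | false rewrite ∧-zeroʳ (adj< G a b) = refl
    ... | false | _     rewrite ∧-zeroʳ (adj< G a b) = refl

    same-count : sum₂ same ≡ 1
    same-count = begin
      sum₂ same                                   ≡⟨ sum-cong-≗ {n G} (λ a → sum-cong-≗ {n G} (same-pointwise a)) ⟩
      sum (λ a → sum (λ b → [ a == i ] * [ b == j ])) ≡⟨ sum-cong-≗ {n G} (λ a → *-distribˡ-sum [ a == i ] (λ b → [ b == j ])) ⟨
      sum (λ a → [ a == i ] * count (_== j))      ≡⟨ sum-delta i (λ _ → count (_== j)) ⟩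
      count (_== j)                               ≡⟨ count-singleton j ⟩
      1                                           ∎
      where open ≡-Reasoning

  S1-length : length (S1 G (i , j)) + 2 ≡ deg G i + deg G j
  S1-length = begin
    length (S1 G (i , j)) + 2                          ≡⟨ cong₂ _+_ (length-filterᵇ-edges G (λ f → not (sameEdge f (i , j)) ∧ shareEnd f (i , j))) (cong (2 *_) (sym same-count)) ⟩
    sum₂ inS1 + 2 * sum₂ same                          ≡⟨ cong (sum₂ inS1 +_) (trans (*-distribˡ-sum 2 (λ a → sum (same a)))
                                                            (sum-cong-≗ {n G} (λ a → *-distribˡ-sum 2 (same a)))) ⟩
    sum₂ inS1 + sum₂ (λ a b → 2 * same a b)            ≡⟨ sum₂-distrib-+ inS1 (λ a b → 2 * same a b) ⟨
    sum₂ (λ a b → inS1 a b + 2 * same a b)             ≡⟨ sum-cong-≗ {n G} (λ a → sum-cong-≗ {n G} (S1-pointwise a)) ⟩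
    sum₂ (λ a b → incident G i a b + incident G j a b) ≡⟨ sum₂-distrib-+ (incident G i) (incident G j) ⟩
    sum₂ (incident G i) + sum₂ (incident G j)          ≡⟨ cong₂ _+_ (incident-count G i) (incident-count G j) ⟩
    deg G i + deg G j                                  ∎
    where open ≡-Reasoning

minList-≤ : ∀ {xs y} → y ∈ xs → minList xs ≤ y
minList-≤ {x ∷ xs} = go x xs
  where
  go : ∀ x xs {y} → y ∈ x ∷ xs → foldr _⊓_ x xs ≤ y
  go x []       (here refl)         = ≤-refl
  go x (z ∷ xs) (here refl)         = ≤-trans (m⊓n≤n z _) (go x xs (here refl))
  go x (z ∷ xs) (there (here refl)) = m⊓n≤m z _
  go x (z ∷ xs) (there (there y∈))  = ≤-trans (m⊓n≤n z _) (go x xs (there y∈))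

minList-∈ : ∀ {xs y} → y ∈ xs → minList xs ∈ xs
minList-∈ {x ∷ xs} _ = go x xs
  where
  go : ∀ x xs → foldr _⊓_ x xs ∈ x ∷ xs
  go x []       = here refl
  go x (z ∷ xs) with ⊓-sel z (foldr _⊓_ x xs)
  ... | inj₁ z⊓m≡z rewrite z⊓m≡z = there (here refl)
  ... | inj₂ z⊓m≡m rewrite z⊓m≡m with go x xs
  ...   | here  m≡x = here m≡x
  ...   | there m∈  = there (there m∈)

module _ (G : Graph) where

  adj-orient : ∀ {x y} → adj G x y ≡ true → adj< G x y ≡ true ⊎ adj< G y x ≡ true
  adj-orient {x} {y} xy with adj< G x y | adj< G y x | adj-split G x y
  ... | true  | _    | _ = inj₁ refl
  ... | false | true | _ = inj₂ refl
  ... | false | false | eq with () ← trans eq (cong [_] xy)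

  private
    cell : Fin (n G) → Fin (n G) → List (Edge G)
    cell a b = if adj< G a b then (a , b) ∷ [] else []

    row : Fin (n G) → List (Edge G)
    row a = concatMap (cell a) (allFin (n G))

  ∈-edges⁺ : ∀ {a b} → adj< G a b ≡ true → (a , b) ∈ edges G
  ∈-edges⁺ {a} {b} ab = ∈-concatMap⁺ row (tabulate⁺ a (∈-concatMap⁺ (cell a) (tabulate⁺ b listed)))
    where
    listed : (a , b) ∈ cell a b
    listed rewrite ab = here refl

  ∈-edges⁻ : ∀ {a b} → (a , b) ∈ edges G → adj< G a b ≡ true
  ∈-edges⁻ ab∈ with tabulate⁻ (∈-concatMap⁻ row ab∈)
  ... | a , ab∈row with tabulate⁻ (∈-concatMap⁻ (cell a) ab∈row)
  ...   | b , ab∈cell with adj< G a b in e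
  ...     | true with here refl ← ab∈cell = e

  private
    some-edge : ∀ {x y} → adj< G x y ≡ true ⊎ adj< G y x ≡ true → ∃ λ e → e ∈ edges G
    some-edge (inj₁ x<y) = _ , ∈-edges⁺ x<y
    some-edge (inj₂ y<x) = _ , ∈-edges⁺ y<x

    minS1+2≤-oriented : ∀ {x y} → adj< G x y ≡ true → minS1 G + 2 ≤ deg G x + deg G y
    minS1+2≤-oriented xy =
      ≤-trans (+-monoˡ-≤ 2 (minList-≤ (∈-map⁺ (λ e → length (S1 G e)) (∈-edges⁺ xy)))) (≤-reflexive (S1-length G xy))

  minS1+2≤ : ∀ {x y} → adj G x y ≡ true → minS1 G + 2 ≤ deg G x + deg G y
  minS1+2≤ xy with adj-orient xy
  ... | inj₁ x<y = minS1+2≤-oriented x<y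
  ... | inj₂ y<x = subst (minS1 G + 2 ≤_) (+-comm (deg G _) _) (minS1+2≤-oriented y<x)

  minS1+2-attained : ∀ {x y} → adj G x y ≡ true →
                     ∃ λ u → ∃ λ v → adj G u v ≡ true × minS1 G + 2 ≡ deg G u + deg G v
  minS1+2-attained xy with ∈-map⁻ (λ e → length (S1 G e)) (minList-∈ (∈-map⁺ (λ e → length (S1 G e)) (proj₂ (some-edge (adj-orient xy)))))
  ... | (u , v) , uv∈ , minS1≡ = u , v , adj<⇒adj G (∈-edges⁻ uv∈) , trans (cong (_+ 2) minS1≡) (S1-length G (∈-edges⁻ uv∈))

  minS1+2≡ : ∀ {s a b} → (∀ {x y} → adj G x y ≡ true → s ≤ deg G x + deg G y) →
             adj G a b ≡ true → deg G a + deg G b ≡ s → minS1 G + 2 ≡ s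
  minS1+2≡ {s} s≤ ab ab≡s = ≤-antisym (subst (minS1 G + 2 ≤_) ab≡s (minS1+2≤ ab)) lower
    where
    lower : s ≤ minS1 G + 2
    lower = let _ , _ , uv , minS1≡ = minS1+2-attained ab in subst (s ≤_) (sym minS1≡) (s≤ uv)

-- Isomorphism invariants

module _ {G H : Graph} (G≅H : G ≅ H) where
  open _≅_ G≅H

  ≅-deg : ∀ i → deg G i ≡ deg H (bij ⟨$⟩ʳ i)
  ≅-deg i = trans (sum-cong-≗ {n G} (λ j → cong [_] (preserve i j))) (sym (∑-permute (λ j → [ adj H (bij ⟨$⟩ʳ i) j ]) bij))

  ≅-adj⁻ : ∀ i j → adj H i j ≡ adj G (bij ⟨$⟩ˡ i) (bij ⟨$⟩ˡ j)
  ≅-adj⁻ i j = trans (cong₂ (adj H) (sym (inverseʳ bij)) (sym (inverseʳ bij))) (sym (preserve _ _))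

  ≅-deg⁻ : ∀ i → deg H i ≡ deg G (bij ⟨$⟩ˡ i)
  ≅-deg⁻ i = trans (cong (deg H) (sym (inverseʳ bij))) (sym (≅-deg _))

  ≅-2*numEdges : 2 * numEdges G ≡ 2 * numEdges H
  ≅-2*numEdges = begin
    2 * numEdges G ≡⟨ handshake G ⟩
    sum (deg G)    ≡⟨ sum-cong-≗ {n G} ≅-deg ⟩
    sum (λ i → deg H (bij ⟨$⟩ʳ i)) ≡⟨ ∑-permute (deg H) bij ⟨
    sum (deg H)    ≡⟨ handshake H ⟨
    2 * numEdges H ∎
    where open ≡-Reasoning

  ≅-minS1 : ∀ {a b} → adj H a b ≡ true → minS1 G ≡ minS1 H
  ≅-minS1 ab = let u , v , uv , minS1H≡ = minS1+2-attained H ab in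
    +-cancelʳ-≡ 2 _ _ (minS1+2≡ G lower (trans (sym (≅-adj⁻ u v)) uv) (sym (trans minS1H≡ (cong₂ _+_ (≅-deg⁻ u) (≅-deg⁻ v)))))
    where
    lower : ∀ {x y} → adj G x y ≡ true → minS1 H + 2 ≤ deg G x + deg G y
    lower xy = subst (minS1 H + 2 ≤_) (sym (cong₂ _+_ (≅-deg _) (≅-deg _))) (minS1+2≤ H (trans (sym (preserve _ _)) xy))

Extremal : Graph → Set
Extremal G = 2 * minS1 G + numVertices G ≡ 2 * numEdges G

HasEdge : Graph → Set
HasEdge H = ∃ λ a → ∃ λ b → adj H a b ≡ true

≅-extremal : ∀ {G H} → G ≅ H → HasEdge H × Extremal H → Extremal G
≅-extremal G≅H ((_ , _ , ab) , extH) =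
  trans (cong₂ (λ m v → 2 * m + v) (≅-minS1 G≅H ab) (↔⇒≡ (_≅_.bij G≅H))) (trans extH (sym (≅-2*numEdges G≅H)))

-- Blow-ups of a pattern: adjacency of distinct vertices depends only on their classes

classBijection : ∀ {n m k} (cG : Fin n → Fin k) (cH : Fin m → Fin k) →
  (∀ t → count (λ i → cG i == t) ≡ count (λ j → cH j == t)) →
  ∃ λ (π : Permutation n m) → ∀ i → cH (π ⟨$⟩ʳ i) ≡ cG i
classBijection {zero}  {zero}  cG cH same = Perm.id , λ ()
classBijection {zero}  {suc m} cG cH same
  with () ← subst (1 ≤_) (sym (same (cH fz))) (1≤count (λ j → cH j == cH fz) (==-refl (cH fz)))
classBijection {suc n} {zero}  cG cH same
  with () ← subst (1 ≤_) (same (cG fz)) (1≤count (λ i → cG i == cG fz) (==-refl (cG fz)))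
classBijection {suc n} {suc m} cG cH same = Perm.insert fz h π , preserved
  where
  h-exists : ∃ λ h → (cH h == cG fz) ≡ true
  h-exists = 1≤count⇒∃ (λ j → cH j == cG fz) (subst (1 ≤_) (same (cG fz)) (1≤count (λ i → cG i == cG fz) (==-refl (cG fz))))
  h = proj₁ h-exists
  same′ : ∀ t → count (λ i → cG (fs i) == t) ≡ count (λ j → cH (punchIn h j) == t)
  same′ t = +-cancelˡ-≡ [ cG fz == t ] _ _ (begin
    count (λ i → cG i == t)                                  ≡⟨ same t ⟩
    count (λ j → cH j == t)                                  ≡⟨ sum-remove (λ j → [ cH j == t ]) ⟩
    [ cH h == t ] + count (λ j → cH (punchIn h j) == t)      ≡⟨ cong (λ c → [ c == t ] + count (λ j → cH (punchIn h j) == t)) (==⇒≡ (proj₂ h-exists)) ⟩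
    [ cG fz == t ] + count (λ j → cH (punchIn h j) == t)     ∎)
    where open ≡-Reasoning
  rest = classBijection (cG ∘ fs) (cH ∘ punchIn h) same′
  π = proj₁ rest
  preserved : ∀ i → cH (Perm.insert fz h π ⟨$⟩ʳ i) ≡ cG i
  preserved fz     = ==⇒≡ (proj₂ h-exists)
  preserved (fs i) = trans (cong cH (Perm.insert-punchIn fz h π i)) (proj₂ rest i)

record BlowUp {k} (G : Graph) (R : Fin k → Fin k → Bool) (size : Fin k → ℕ) : Set where
  field
    class      : Fin (n G) → Fin k
    adj-class  : ∀ i j → adj G i j ≡ (not (i == j) ∧ R (class i) (class j))
    class-size : ∀ t → count (λ i → class i == t) ≡ size t

blowUp-≅ : ∀ {k G H} {R : Fin k → Fin k → Bool} {size} → BlowUp G R size → BlowUp H R size → G ≅ H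
blowUp-≅ {G = G} {H} {R} BG BH = record { bij = π ; preserve = preserve }
  where
  module BG = BlowUp BG
  module BH = BlowUp BH
  bijection = classBijection BG.class BH.class (λ t → trans (BG.class-size t) (sym (BH.class-size t)))
  π = proj₁ bijection
  π-injective : ∀ {i j} → π ⟨$⟩ʳ i ≡ π ⟨$⟩ʳ j → i ≡ j
  π-injective e = trans (sym (inverseˡ π)) (trans (cong (π ⟨$⟩ˡ_) e) (inverseˡ π))
  preserve : ∀ i j → adj G i j ≡ adj H (π ⟨$⟩ʳ i) (π ⟨$⟩ʳ j)
  preserve i j = begin
    adj G i j                                                       ≡⟨ BG.adj-class i j ⟩
    not (i == j) ∧ R (BG.class i) (BG.class j)                      ≡⟨ cong₂ (λ b r → not b ∧ r)
                                                                         (==-injective (π ⟨$⟩ʳ_) π-injective i j)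
                                                                         (cong₂ R (proj₂ bijection i) (proj₂ bijection j)) ⟨
    not ((π ⟨$⟩ʳ i) == (π ⟨$⟩ʳ j)) ∧ R (BH.class (π ⟨$⟩ʳ i)) (BH.class (π ⟨$⟩ʳ j)) ≡⟨ BH.adj-class _ _ ⟨
    adj H (π ⟨$⟩ʳ i) (π ⟨$⟩ʳ j)                                     ∎
    where open ≡-Reasoning

module BlowUpDegrees {k H} {R : Fin k → Fin k → Bool} {size} (R-irrefl : ∀ t → R t t ≡ false) (B : BlowUp H R size) where
  open BlowUp B

  sum-by-class : (f : Fin k → ℕ) → sum (λ j → f (class j)) ≡ sum (λ t → f t * size t)
  sum-by-class f = begin
    sum (λ j → f (class j))                                ≡⟨ sum-cong-≗ {n H} (λ j → sum-delta (class j) f) ⟨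
    sum (λ j → sum (λ t → [ t == class j ] * f t))         ≡⟨ ∑-comm (λ j t → [ t == class j ] * f t) ⟩
    sum (λ t → sum (λ j → [ t == class j ] * f t))         ≡⟨ sum-cong-≗ {k} (λ t → *-distribʳ-sum (f t) (λ j → [ t == class j ])) ⟨
    sum (λ t → count (λ j → t == class j) * f t)           ≡⟨ sum-cong-≗ {k} (λ t → cong (_* f t) (trans (sum-cong-≗ {n H} (λ j → cong [_] (==-sym t (class j)))) (class-size t))) ⟩
    sum (λ t → size t * f t)                               ≡⟨ sum-cong-≗ {k} (λ t → *-comm (size t) (f t)) ⟩
    sum (λ t → f t * size t)                               ∎
    where open ≡-Reasoning

  deg-by-class : ∀ i → deg H i ≡ sum (λ t → [ R (class i) t ] * size t)
  deg-by-class i = trans (sum-cong-≗ {n H} adj-by-class) (sum-by-class (λ t → [ R (class i) t ]))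
    where
    adj-by-class : ∀ j → [ adj H i j ] ≡ [ R (class i) (class j) ]
    adj-by-class j rewrite adj-class i j with i == j in e
    ... | false = refl
    ... | true rewrite ==⇒≡ e | R-irrefl (class j) = refl

  edge-between : ∀ {t u} → R t u ≡ true → 1 ≤ size t → 1 ≤ size u →
                 ∃ λ a → ∃ λ b → adj H a b ≡ true × class a ≡ t × class b ≡ u
  edge-between {t} {u} tu t-inhabited u-inhabited with 1≤count⇒∃ (λ i → class i == t) (subst (1 ≤_) (sym (class-size t)) t-inhabited)
                                                       | 1≤count⇒∃ (λ i → class i == u) (subst (1 ≤_) (sym (class-size u)) u-inhabited)
  ... | a , at | b , bu = a , b , ab , ==⇒≡ at , ==⇒≡ bu
    where
    R-ab : R (class a) (class b) ≡ true
    R-ab = trans (cong₂ R (==⇒≡ at) (==⇒≡ bu)) tu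
    a≢b : a ≢ b
    a≢b refl with () ← trans (sym R-ab) (R-irrefl (class a))
    ab : adj H a b ≡ true
    ab rewrite adj-class a b | ≢⇒==false a≢b = R-ab

-- Perfect matchings

record PerfectMatching (G : Graph) : Set where
  field
    partner     : Fin (n G) → Fin (n G)
    adj-partner : ∀ i j → adj G i j ≡ (j == partner i)

module PerfectMatchingProperties {G} (M : PerfectMatching G) where
  open PerfectMatching M

  partner-involutive : ∀ i → partner (partner i) ≡ i
  partner-involutive i = sym (==⇒≡ (trans (sym (adj-partner (partner i) i))
                                          (trans (adj-sym G (partner i) i) (trans (adj-partner i (partner i)) (==-refl _)))))

  partner-≢ : ∀ i → partner i ≢ i
  partner-≢ i e with () ← trans (sym (irrefl G i)) (trans (adj-partner i i) (subst (λ x → (i == x) ≡ true) (sym e) (==-refl i)))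

  partner-perm : Permutation (n G) (n G)
  partner-perm = Perm.permutation partner partner partner-involutive partner-involutive

  lower : Fin (n G) → Bool
  lower i = toℕ i <ᵇ toℕ (partner i)

  lower-partner : ∀ i → lower (partner i) ≡ not (lower i)
  lower-partner i with <-cmp (toℕ i) (toℕ (partner i))
  ... | tri< i<p _ _ rewrite partner-involutive i | <⇒<ᵇ≡true i<p = ≤⇒<ᵇ≡false (<⇒≤ i<p)
  ... | tri> _ _ p<i rewrite partner-involutive i | <⇒<ᵇ≡true p<i | ≤⇒<ᵇ≡false (<⇒≤ p<i) = refl
  ... | tri≈ _ i≡p _ with () ← partner-≢ i (sym (toℕ-injective i≡p))

  count-not-lower : count (not ∘ lower) ≡ count lower
  count-not-lower = trans (sum-cong-≗ {n G} (λ i → cong [_] (sym (lower-partner i))))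
                          (sym (∑-permute (λ i → [ lower i ]) partner-perm))

  2*count-lower : 2 * count lower ≡ n G
  2*count-lower = begin
    count lower + (count lower + 0)    ≡⟨ cong (count lower +_) (trans (+-identityʳ _) (sym count-not-lower)) ⟩
    count lower + count (not ∘ lower)  ≡⟨ count-split (λ _ → true) lower ⟨
    count {n G} (λ _ → true)           ≡⟨ count-true (n G) ⟩
    n G                                ∎
    where open ≡-Reasoning

-- Match the lower ends (i < partner i) of the edges of G and H bijectively, and extend to the partners.
module _ {G H : Graph} (nG≡nH : n G ≡ n H) (MG : PerfectMatching G) (MH : PerfectMatching H) where
  private
    module MG = PerfectMatching MG
    module MH = PerfectMatching MH
    module PG = PerfectMatchingProperties MG
    module PH = PerfectMatchingProperties MH

    side : Bool → Fin 2
    side true  = 0F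
    side false = 1F

    side-injective : ∀ {a b} → side a ≡ side b → a ≡ b
    side-injective {true}  {true}  _ = refl
    side-injective {false} {false} _ = refl

    count-side : ∀ {m} (p : Fin m → Bool) t → count (λ i → side (p i) == t) ≡ count (if t == 0F then p else not ∘ p)
    count-side p 0F = sum-cong-≗ (λ i → lemma (p i))
      where lemma : ∀ b → [ side b == 0F ] ≡ [ b ]
            lemma true  = refl
            lemma false = refl
    count-side p 1F = sum-cong-≗ (λ i → lemma (p i))
      where lemma : ∀ b → [ side b == 1F ] ≡ [ not b ]
            lemma true  = refl
            lemma false = refl

    same-lower : count PG.lower ≡ count PH.lower
    same-lower = *-cancelˡ-≡ _ _ 2 (trans PG.2*count-lower (trans nG≡nH (sym PH.2*count-lower)))

    same-counts : ∀ t → count (λ i → side (PG.lower i) == t) ≡ count (λ j → side (PH.lower j) == t)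
    same-counts 0F = trans (count-side PG.lower 0F) (trans same-lower (sym (count-side PH.lower 0F)))
    same-counts 1F = trans (count-side PG.lower 1F) (trans (trans PG.count-not-lower (trans same-lower (sym PH.count-not-lower)))
                                                            (sym (count-side PH.lower 1F)))

    bijection = classBijection (side ∘ PG.lower) (side ∘ PH.lower) same-counts
    σ = proj₁ bijection

    σ-lower : ∀ i → PH.lower (σ ⟨$⟩ʳ i) ≡ PG.lower i
    σ-lower i = side-injective (proj₂ bijection i)

    σ⁻¹-lower : ∀ j → PG.lower (σ ⟨$⟩ˡ j) ≡ PH.lower j
    σ⁻¹-lower j = trans (sym (σ-lower (σ ⟨$⟩ˡ j))) (cong PH.lower (inverseʳ σ))

    τ : Fin (n G) → Fin (n H)
    τ i = if PG.lower i then σ ⟨$⟩ʳ i else MH.partner (σ ⟨$⟩ʳ MG.partner i)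

    τ⁻¹ : Fin (n H) → Fin (n G)
    τ⁻¹ j = if PH.lower j then σ ⟨$⟩ˡ j else MG.partner (σ ⟨$⟩ˡ MH.partner j)

    τ⁻¹-τ : ∀ i → τ⁻¹ (τ i) ≡ i
    τ⁻¹-τ i with PG.lower i in e
    ... | true  rewrite σ-lower i | e = inverseˡ σ
    ... | false rewrite PH.lower-partner (σ ⟨$⟩ʳ MG.partner i) | σ-lower (MG.partner i) | PG.lower-partner i | e
                      | PH.partner-involutive (σ ⟨$⟩ʳ MG.partner i) | inverseˡ σ {MG.partner i} = PG.partner-involutive i

    τ-τ⁻¹ : ∀ j → τ (τ⁻¹ j) ≡ j
    τ-τ⁻¹ j with PH.lower j in e
    ... | true  rewrite σ⁻¹-lower j | e = inverseʳ σ
    ... | false rewrite PG.lower-partner (σ ⟨$⟩ˡ MH.partner j) | σ⁻¹-lower (MH.partner j) | PH.lower-partner j | e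
                      | PG.partner-involutive (σ ⟨$⟩ˡ MH.partner j) | inverseʳ σ {MH.partner j} = PH.partner-involutive j

    τ-partner : ∀ i → MH.partner (τ i) ≡ τ (MG.partner i)
    τ-partner i with PG.lower i in e
    ... | true  rewrite PG.lower-partner i | e | PG.partner-involutive i = refl
    ... | false rewrite PG.lower-partner i | e = PH.partner-involutive _

    τ-injective : ∀ {i j} → τ i ≡ τ j → i ≡ j
    τ-injective {i} {j} e = trans (sym (τ⁻¹-τ i)) (trans (cong τ⁻¹ e) (τ⁻¹-τ j))

    preserve : ∀ i j → adj G i j ≡ adj H (τ i) (τ j)
    preserve i j = begin
      adj G i j                    ≡⟨ MG.adj-partner i j ⟩
      (j == MG.partner i)          ≡⟨ ==-injective τ τ-injective j (MG.partner i) ⟨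
      (τ j == τ (MG.partner i))    ≡⟨ cong (τ j ==_) (τ-partner i) ⟨
      (τ j == MH.partner (τ i))    ≡⟨ MH.adj-partner (τ i) (τ j) ⟨
      adj H (τ i) (τ j)            ∎
      where open ≡-Reasoning

  perfectMatching-≅ : G ≅ H
  perfectMatching-≅ = record { bij = Perm.permutation τ τ⁻¹ τ-τ⁻¹ τ⁻¹-τ ; preserve = preserve }

Linked : List (ℕ × ℕ) → ℕ → ℕ → Set
Linked es x y = (x , y) ∈ es ⊎ (y , x) ∈ es

hit⇒ : ∀ {x y a b} → hit x y (a , b) ≡ true → (a ≡ x × b ≡ y) ⊎ (a ≡ y × b ≡ x)
hit⇒ h = Sum.map both both (Equivalence.to T-∨ (Equivalence.from T-≡ h))
  where
  both : ∀ {c d e f} → T ((c ≡ᵇ d) ∧ (e ≡ᵇ f)) → c ≡ d × e ≡ f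
  both t = ≡ᵇ⇒≡ _ _ (proj₁ (Equivalence.to T-∧ t)) , ≡ᵇ⇒≡ _ _ (proj₂ (Equivalence.to T-∧ t))

hit-same : ∀ x y → hit x y (x , y) ≡ true
hit-same x y rewrite ≡⇒≡ᵇ-true (refl {x = x}) | ≡⇒≡ᵇ-true (refl {x = y}) = refl

hit-swapped : ∀ x y → hit x y (y , x) ≡ true
hit-swapped x y rewrite ≡⇒≡ᵇ-true (refl {x = x}) | ≡⇒≡ᵇ-true (refl {x = y}) = ∨-zeroʳ _

any-hit⇒Linked : ∀ es {x y} → any (hit x y) es ≡ true → Linked es x y
any-hit⇒Linked ((a , b) ∷ es) {x} {y} e with hit x y (a , b) in h
... | false = Sum.map there there (any-hit⇒Linked es e)
... | true with hit⇒ {x} {y} {a} {b} h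
...   | inj₁ (refl , refl) = inj₁ (here refl)
...   | inj₂ (refl , refl) = inj₂ (here refl)

Linked⇒any-hit : ∀ es {x y} → Linked es x y → any (hit x y) es ≡ true
Linked⇒any-hit ((a , b) ∷ es) {x} {y} (inj₁ (here refl))  rewrite hit-same x y = refl
Linked⇒any-hit ((a , b) ∷ es) {x} {y} (inj₂ (here refl))  rewrite hit-swapped x y = refl
Linked⇒any-hit ((a , b) ∷ es) {x} {y} (inj₁ (there xy∈)) rewrite Linked⇒any-hit es (inj₁ xy∈) = ∨-zeroʳ _
Linked⇒any-hit ((a , b) ∷ es) {x} {y} (inj₂ (there yx∈)) rewrite Linked⇒any-hit es (inj₂ yx∈) = ∨-zeroʳ _

toℕ-≡ᵇ : ∀ {m} (i j : Fin m) → (toℕ i ≡ᵇ toℕ j) ≡ (i == j)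
toℕ-≡ᵇ i j = bool-ext (λ e → subst (λ x → (i == x) ≡ true) (toℕ-injective (≡ᵇ⇒≡-true e)) (==-refl i))
                      (λ e → ≡⇒≡ᵇ-true (cong toℕ (==⇒≡ e)))

undirected : ∀ {k} → (Fin k → Fin k → Bool) → Fin k → Fin k → Bool
undirected E t u = E t u ∨ E u t

fromEdges-blowUp : ∀ {k} N es (class : ℕ → Fin k) (E : Fin k → Fin k → Bool) {size} →
  (∀ {x y} → (x , y) ∈ es → E (class x) (class y) ≡ true) →
  (∀ {x y} → x < N → y < N → E (class x) (class y) ≡ true → (x , y) ∈ es) →
  (∀ t → count {N} (λ i → class (toℕ i) == t) ≡ size t) →
  BlowUp (fromEdges N es) (undirected E) size
fromEdges-blowUp N es class E edge⇒E E⇒edge sizes = record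
  { class = class ∘ toℕ ; adj-class = adj-class ; class-size = sizes }
  where
  linked⇒E : ∀ {x y} → Linked es x y → undirected E (class x) (class y) ≡ true
  linked⇒E (inj₁ xy∈) rewrite edge⇒E xy∈ = refl
  linked⇒E (inj₂ yx∈) rewrite edge⇒E yx∈ = ∨-zeroʳ _
  E⇒linked : ∀ {x y} → x < N → y < N → undirected E (class x) (class y) ≡ true → Linked es x y
  E⇒linked x<N y<N e = Sum.map (E⇒edge x<N y<N) (E⇒edge y<N x<N) (∨-true e)
  adj-class : ∀ i j → adj (fromEdges N es) i j ≡ (not (i == j) ∧ undirected E (class (toℕ i)) (class (toℕ j)))
  adj-class i j rewrite toℕ-≡ᵇ i j with i == j
  ... | true  = refl
  ... | false = bool-ext (linked⇒E ∘ any-hit⇒Linked es)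
                         (Linked⇒any-hit es ∘ E⇒linked (toℕ<n i) (toℕ<n j))

-- The labels 0, 1, 2, … cut into consecutive blocks of sizes s₀, s₁, s₂ and
-- an unbounded last block.

block : ℕ → ℕ → ℕ → ℕ → Fin 4
block (suc s₀) s₁       s₂       zero    = 0F
block (suc s₀) s₁       s₂       (suc x) = block s₀ s₁ s₂ x
block zero     (suc s₁) s₂       zero    = 1F
block zero     (suc s₁) s₂       (suc x) = block zero s₁ s₂ x
block zero     zero     (suc s₂) zero    = 2F
block zero     zero     (suc s₂) (suc x) = block zero zero s₂ x
block zero     zero     zero     x       = 3F

data BlockView (s₀ s₁ s₂ : ℕ) : ℕ → Fin 4 → Set where
  in₀ : ∀ {j} → j < s₀ → BlockView s₀ s₁ s₂ j 0F
  in₁ : ∀ {j} → j < s₁ → BlockView s₀ s₁ s₂ (s₀ + j) 1F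
  in₂ : ∀ {j} → j < s₂ → BlockView s₀ s₁ s₂ (s₀ + s₁ + j) 2F
  in₃ : ∀ j → BlockView s₀ s₁ s₂ (s₀ + s₁ + s₂ + j) 3F

blockView : ∀ s₀ s₁ s₂ x → BlockView s₀ s₁ s₂ x (block s₀ s₁ s₂ x)
blockView (suc s₀) s₁ s₂ zero = in₀ z<s
blockView (suc s₀) s₁ s₂ (suc x) with block s₀ s₁ s₂ x | blockView s₀ s₁ s₂ x
... | _ | in₀ j<s₀ = in₀ (s<s j<s₀)
... | _ | in₁ j<s₁ = in₁ j<s₁
... | _ | in₂ j<s₂ = in₂ j<s₂
... | _ | in₃ j    = in₃ j
blockView zero (suc s₁) s₂ zero = in₁ z<s
blockView zero (suc s₁) s₂ (suc x) with block zero s₁ s₂ x | blockView zero s₁ s₂ x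
... | _ | in₁ j<s₁ = in₁ (s<s j<s₁)
... | _ | in₂ j<s₂ = in₂ j<s₂
... | _ | in₃ j    = in₃ j
blockView zero zero (suc s₂) zero = in₂ z<s
blockView zero zero (suc s₂) (suc x) with block zero zero s₂ x | blockView zero zero s₂ x
... | _ | in₂ j<s₂ = in₂ (s<s j<s₂)
... | _ | in₃ j    = in₃ j
blockView zero zero zero x = in₃ x

block-skip₀ : ∀ s₀ s₁ s₂ x → block s₀ s₁ s₂ (s₀ + x) ≡ block zero s₁ s₂ x
block-skip₀ zero     s₁ s₂ x = refl
block-skip₀ (suc s₀) s₁ s₂ x = block-skip₀ s₀ s₁ s₂ x

block-skip₁ : ∀ s₁ s₂ x → block zero s₁ s₂ (s₁ + x) ≡ block zero zero s₂ x
block-skip₁ zero     s₂ x = refl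
block-skip₁ (suc s₁) s₂ x = block-skip₁ s₁ s₂ x

block-skip₂ : ∀ s₂ x → block zero zero s₂ (s₂ + x) ≡ 3F
block-skip₂ zero     x = refl
block-skip₂ (suc s₂) x = block-skip₂ s₂ x

block₀ : ∀ {s₀ s₁ s₂ x} → x < s₀ → block s₀ s₁ s₂ x ≡ 0F
block₀ {suc s₀} {x = zero}  _          = refl
block₀ {suc s₀} {x = suc x} (s<s x<s₀) = block₀ x<s₀

block₁ : ∀ s₀ {s₁ s₂ j} → j < s₁ → block s₀ s₁ s₂ (s₀ + j) ≡ 1F
block₁ s₀ j<s₁ = trans (block-skip₀ s₀ _ _ _) (go j<s₁)
  where
  go : ∀ {s₁ s₂ j} → j < s₁ → block zero s₁ s₂ j ≡ 1F
  go {suc s₁} {j = zero}  _          = refl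
  go {suc s₁} {j = suc j} (s<s j<s₁) = go j<s₁

block₂ : ∀ s₀ s₁ {s₂ j} → j < s₂ → block s₀ s₁ s₂ (s₀ + s₁ + j) ≡ 2F
block₂ s₀ s₁ {j = j} j<s₂ rewrite +-assoc s₀ s₁ j = trans (block-skip₀ s₀ _ _ _) (trans (block-skip₁ s₁ _ _) (go j<s₂))
  where
  go : ∀ {s₂ j} → j < s₂ → block zero zero s₂ j ≡ 2F
  go {suc s₂} {zero}  _          = refl
  go {suc s₂} {suc j} (s<s j<s₂) = go j<s₂

block₃ : ∀ s₀ s₁ s₂ j → block s₀ s₁ s₂ (s₀ + s₁ + s₂ + j) ≡ 3F
block₃ s₀ s₁ s₂ j rewrite +-assoc (s₀ + s₁) s₂ j | +-assoc s₀ s₁ (s₂ + j) =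
  trans (block-skip₀ s₀ _ _ _) (trans (block-skip₁ s₁ _ _) (block-skip₂ s₂ j))

blockSize : ℕ → ℕ → ℕ → ℕ → Fin 4 → ℕ
blockSize s₀ s₁ s₂ s₃ 0F = s₀
blockSize s₀ s₁ s₂ s₃ 1F = s₁
blockSize s₀ s₁ s₂ s₃ 2F = s₂
blockSize s₀ s₁ s₂ s₃ 3F = s₃

count-block : ∀ s₀ s₁ s₂ s₃ t →
  count {s₀ + s₁ + s₂ + s₃} (λ i → block s₀ s₁ s₂ (toℕ i) == t) ≡ blockSize s₀ s₁ s₂ s₃ t
count-block (suc s₀) s₁ s₂ s₃ t = trans (cong ([ 0F == t ] +_) (count-block s₀ s₁ s₂ s₃ t)) (step t)
  where
  step : ∀ t → [ 0F == t ] + blockSize s₀ s₁ s₂ s₃ t ≡ blockSize (suc s₀) s₁ s₂ s₃ t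
  step 0F = refl
  step 1F = refl
  step 2F = refl
  step 3F = refl
count-block zero (suc s₁) s₂ s₃ t = trans (cong ([ 1F == t ] +_) (count-block zero s₁ s₂ s₃ t)) (step t)
  where
  step : ∀ t → [ 1F == t ] + blockSize zero s₁ s₂ s₃ t ≡ blockSize zero (suc s₁) s₂ s₃ t
  step 0F = refl
  step 1F = refl
  step 2F = refl
  step 3F = refl
count-block zero zero (suc s₂) s₃ t = trans (cong ([ 2F == t ] +_) (count-block zero zero s₂ s₃ t)) (step t)
  where
  step : ∀ t → [ 2F == t ] + blockSize zero zero s₂ s₃ t ≡ blockSize zero zero (suc s₂) s₃ t
  step 0F = refl
  step 1F = refl
  step 2F = refl
  step 3F = refl
count-block zero zero zero s₃ 0F = trans (sum-const s₃ 0) (*-zeroʳ s₃)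
count-block zero zero zero s₃ 1F = trans (sum-const s₃ 0) (*-zeroʳ s₃)
count-block zero zero zero s₃ 2F = trans (sum-const s₃ 0) (*-zeroʳ s₃)
count-block zero zero zero s₃ 3F = count-true s₃

-- Classes 0F and 2F are two centres, 1F and 3F their leaves; the centres are adjacent iff linked,
-- so the pattern describes two disjoint stars (H² and H³) or the double star H⁴.
twoCentresArc : Bool → Fin 4 → Fin 4 → Bool
twoCentresArc linked 0F 1F = true
twoCentresArc linked 2F 3F = true
twoCentresArc linked 0F 2F = linked
twoCentresArc linked _  _  = false

twoStarsArc : Fin 4 → Fin 4 → Bool
twoStarsArc = twoCentresArc false

module _ (k : ℕ) where
  private
    leaves₁ leaves₂ : List (ℕ × ℕ)
    leaves₁ = map (λ j → (0 , suc j)) (upTo k)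
    leaves₂ = map (λ j → (suc k , k + 2 + j)) (upTo k)

    class : ℕ → Fin 4
    class = block 1 k 1

    vertices : 1 + k + 1 + k ≡ 2 * k + 2
    vertices = lemma k
      where lemma : ∀ k → 1 + k + 1 + k ≡ 2 * k + 2
            lemma = solve-∀

    centre₂ : 1 + k + 0 ≡ suc k
    centre₂ = +-identityʳ (suc k)

    leaf₂ : ∀ j → 1 + k + 1 + j ≡ k + 2 + j
    leaf₂ j = cong (_+ j) (sym (+-suc k 1))

    edge⇒arc : ∀ {x y} → (x , y) ∈ leaves₁ ++ leaves₂ → twoStarsArc (class x) (class y) ≡ true
    edge⇒arc xy∈ with ∈-++⁻ leaves₁ xy∈
    ... | inj₁ ∈₁ with ∈-map⁻ _ ∈₁
    ...   | j , j∈ , refl = cong (twoStarsArc 0F) (block₁ 1 (∈-upTo⁻ j∈))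
    edge⇒arc xy∈ | inj₂ ∈₂ with ∈-map⁻ _ ∈₂
    ...   | j , j∈ , refl = cong₂ twoStarsArc (subst (λ x → class x ≡ 2F) centre₂ (block₂ 1 k z<s))
                                              (subst (λ x → class x ≡ 3F) (leaf₂ j) (block₃ 1 k 1 j))

    views⇒edge : ∀ {x y c d} → y < 2 * k + 2 → BlockView 1 k 1 x c → BlockView 1 k 1 y d →
                 twoStarsArc c d ≡ true → (x , y) ∈ leaves₁ ++ leaves₂
    views⇒edge _   (in₀ z<s) (in₁ j<k) _ = ∈-++⁺ˡ (∈-map⁺ _ (∈-upTo⁺ j<k))
    views⇒edge y<N (in₂ z<s) (in₃ j)   _ = ∈-++⁺ʳ leaves₁
      (subst₂ (λ x y → (x , y) ∈ leaves₂) (sym centre₂) (sym (leaf₂ j))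
              (∈-map⁺ _ (∈-upTo⁺ (+-cancelˡ-< (1 + k + 1) j k (subst (1 + k + 1 + j <_) (sym vertices) y<N)))))
    views⇒edge _ (in₀ _) (in₀ _) ()
    views⇒edge _ (in₀ _) (in₂ _) ()
    views⇒edge _ (in₀ _) (in₃ _) ()
    views⇒edge _ (in₁ _) _       ()
    views⇒edge _ (in₂ _) (in₀ _) ()
    views⇒edge _ (in₂ _) (in₁ _) ()
    views⇒edge _ (in₂ _) (in₂ _) ()
    views⇒edge _ (in₃ _) _       ()

  twoStars-blowUp : BlowUp (twoStars k) (undirected twoStarsArc) (blockSize 1 k 1 k)
  twoStars-blowUp = fromEdges-blowUp (2 * k + 2) (leaves₁ ++ leaves₂) class twoStarsArc edge⇒arc
    (λ {x} {y} _ y<N → views⇒edge y<N (blockView 1 k 1 x) (blockView 1 k 1 y))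
    (λ t → subst (λ N → count {N} (λ i → class (toℕ i) == t) ≡ blockSize 1 k 1 k t) vertices (count-block 1 k 1 k t))

module _ (m : ℕ) where
  private
    leaves : List (ℕ × ℕ)
    leaves = map (λ j → (0 , suc j)) (upTo m)

    class : ℕ → Fin 4
    class = block 1 m 0

    edge⇒arc : ∀ {x y} → (x , y) ∈ leaves → twoStarsArc (class x) (class y) ≡ true
    edge⇒arc xy∈ with ∈-map⁻ _ xy∈
    ... | j , j∈ , refl = cong (twoStarsArc 0F) (block₁ 1 (∈-upTo⁻ j∈))

    views⇒edge : ∀ {x y c d} → BlockView 1 m 0 x c → BlockView 1 m 0 y d → twoStarsArc c d ≡ true → (x , y) ∈ leaves
    views⇒edge (in₀ z<s) (in₁ j<m) _ = ∈-map⁺ _ (∈-upTo⁺ j<m)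
    views⇒edge (in₀ _)   (in₀ _)   ()
    views⇒edge (in₀ _)   (in₃ _)   ()
    views⇒edge (in₁ _)   _         ()
    views⇒edge (in₃ _)   _         ()

  star-blowUp : BlowUp (star m) (undirected twoStarsArc) (blockSize 1 m 0 0)
  star-blowUp = fromEdges-blowUp (suc m) leaves class twoStarsArc edge⇒arc
    (λ {x} {y} _ _ → views⇒edge (blockView 1 m 0 x) (blockView 1 m 0 y))
    (λ t → subst (λ N → count {N} (λ i → class (toℕ i) == t) ≡ blockSize 1 m 0 0 t) (vertices m) (count-block 1 m 0 0 t))
    where
    vertices : ∀ m → 1 + m + 0 + 0 ≡ suc m
    vertices = solve-∀

doubleStarArc : Fin 4 → Fin 4 → Bool
doubleStarArc 0F 2F = true
doubleStarArc 0F 3F = true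
doubleStarArc 1F 3F = true
doubleStarArc _  _  = false

module _ (b : ℕ) where
  private
    k = suc b

    leaves₁ leaves₂ : List (ℕ × ℕ)
    leaves₁ = map (λ j → (0 , k + j)) (upTo k)
    leaves₂ = map (λ i → (i , k + k ∸ 1)) (upTo k)

    class : ℕ → Fin 4
    class = block 1 b b

    vertices : 1 + b + b + 1 ≡ 2 * k
    vertices = lemma b
      where lemma : ∀ b → 1 + b + b + 1 ≡ 2 * suc b
            lemma = solve-∀

    centre₂ : 1 + b + b + 0 ≡ k + k ∸ 1
    centre₂ = lemma b
      where lemma : ∀ b → 1 + b + b + 0 ≡ b + suc b
            lemma = solve-∀

    class-centre₂ : class (k + k ∸ 1) ≡ 3F
    class-centre₂ = subst (λ x → class x ≡ 3F) centre₂ (block₃ 1 b b 0)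

    edge⇒arc : ∀ {x y} → (x , y) ∈ leaves₁ ++ leaves₂ → doubleStarArc (class x) (class y) ≡ true
    edge⇒arc xy∈ with ∈-++⁻ leaves₁ xy∈
    ... | inj₁ ∈₁ with ∈-map⁻ _ ∈₁
    ...   | j , j∈ , refl with m<1+n⇒m<n∨m≡n (∈-upTo⁻ j∈)
    ...     | inj₁ j<b  = cong (doubleStarArc 0F) (block₂ 1 b j<b)
    ...     | inj₂ refl = cong (doubleStarArc 0F) (subst (λ x → class x ≡ 3F) (+-identityʳ (k + b)) (block₃ 1 b b 0))
    edge⇒arc xy∈ | inj₂ ∈₂ with ∈-map⁻ _ ∈₂
    ...   | zero  , _  , refl = cong (doubleStarArc 0F) class-centre₂
    ...   | suc i , i∈ , refl = cong₂ doubleStarArc (block₁ 1 (≤-pred (∈-upTo⁻ i∈))) class-centre₂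

    last-label : ∀ {j} → 1 + b + b + j < 2 * k → j ≡ 0
    last-label {j} y<N = n<1⇒n≡0 (+-cancelˡ-< (1 + b + b) j 1 (subst (1 + b + b + j <_) (sym vertices) y<N))

    views⇒edge : ∀ {x y c d} → y < 2 * k → BlockView 1 b b x c → BlockView 1 b b y d →
                 doubleStarArc c d ≡ true → (x , y) ∈ leaves₁ ++ leaves₂
    views⇒edge _   (in₀ z<s) (in₂ j<b) _ = ∈-++⁺ˡ (∈-map⁺ _ (∈-upTo⁺ (m<n⇒m<1+n j<b)))
    views⇒edge y<N (in₀ z<s) (in₃ j)   _ rewrite last-label y<N =
      ∈-++⁺ʳ leaves₁ (subst (λ y → (0 , y) ∈ leaves₂) (sym centre₂) (∈-map⁺ _ (∈-upTo⁺ z<s)))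
    views⇒edge y<N (in₁ {i} i<b) (in₃ j) _ rewrite last-label y<N =
      ∈-++⁺ʳ leaves₁ (subst (λ y → (suc i , y) ∈ leaves₂) (sym centre₂) (∈-map⁺ _ (∈-upTo⁺ (s<s i<b))))
    views⇒edge _ (in₀ _) (in₀ _) ()
    views⇒edge _ (in₀ _) (in₁ _) ()
    views⇒edge _ (in₁ _) (in₀ _) ()
    views⇒edge _ (in₁ _) (in₁ _) ()
    views⇒edge _ (in₁ _) (in₂ _) ()
    views⇒edge _ (in₂ _) _       ()
    views⇒edge _ (in₃ _) _       ()

  doubleStar-blowUp : BlowUp (H4tree (suc b)) (undirected doubleStarArc) (blockSize 1 b b 1)
  doubleStar-blowUp = fromEdges-blowUp (2 * k) (leaves₁ ++ leaves₂) class doubleStarArc edge⇒arc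
    (λ {x} {y} _ y<N → views⇒edge y<N (blockView 1 b b x) (blockView 1 b b y))
    (λ t → subst (λ N → count {N} (λ i → class (toℕ i) == t) ≡ blockSize 1 b b 1 t) vertices (count-block 1 b b 1 t))

data Parity : ℕ → Set where
  even : ∀ i → Parity (2 * i)
  odd  : ∀ i → Parity (suc (2 * i))

2*suc : ∀ i → 2 * suc i ≡ suc (suc (2 * i))
2*suc = solve-∀

parity : ∀ x → Parity x
parity zero          = even 0
parity (suc zero)    = odd 0
parity (suc (suc x)) with parity x
... | even i = subst Parity (2*suc i) (even (suc i))
... | odd  i = subst Parity (cong suc (2*suc i)) (odd (suc i))

flipParity : ℕ → ℕ
flipParity zero          = 1
flipParity (suc zero)    = 0
flipParity (suc (suc x)) = suc (suc (flipParity x))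

flipParity-even : ∀ i → flipParity (2 * i) ≡ suc (2 * i)
flipParity-even zero    = refl
flipParity-even (suc i) = begin
  flipParity (2 * suc i)              ≡⟨ cong flipParity (2*suc i) ⟩
  suc (suc (flipParity (2 * i)))      ≡⟨ cong (suc ∘ suc) (flipParity-even i) ⟩
  suc (suc (suc (2 * i)))             ≡⟨ cong suc (2*suc i) ⟨
  suc (2 * suc i)                     ∎
  where open ≡-Reasoning

flipParity-odd : ∀ i → flipParity (suc (2 * i)) ≡ 2 * i
flipParity-odd zero    = refl
flipParity-odd (suc i) = begin
  flipParity (suc (2 * suc i))        ≡⟨ cong (flipParity ∘ suc) (2*suc i) ⟩
  suc (suc (flipParity (suc (2 * i)))) ≡⟨ cong (suc ∘ suc) (flipParity-odd i) ⟩
  suc (suc (2 * i))                   ≡⟨ 2*suc i ⟨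
  2 * suc i                           ∎
  where open ≡-Reasoning

module _ (m : ℕ) where
  private
    pairs : List (ℕ × ℕ)
    pairs = map (λ i → (2 * i , suc (2 * i))) (upTo m)

    linked⇒flipParity : ∀ {x y} → Linked pairs x y → y ≡ flipParity x
    linked⇒flipParity (inj₁ xy∈) with ∈-map⁻ _ xy∈
    ... | i , _ , refl = sym (flipParity-even i)
    linked⇒flipParity (inj₂ yx∈) with ∈-map⁻ _ yx∈
    ... | i , _ , refl = sym (flipParity-odd i)

    half< : ∀ {i} → suc (2 * i) < 2 * m → i < m
    half< {i} 2i+1<2m = *-cancelˡ-< 2 i m (<-trans (n<1+n (2 * i)) 2i+1<2m)

    flipParity⇒linked : ∀ {x} → x < 2 * m → Linked pairs x (flipParity x)
    flipParity⇒linked {x} x<2m with parity x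
    ... | even i rewrite flipParity-even i = inj₁ (∈-map⁺ (λ i → (2 * i , suc (2 * i))) (∈-upTo⁺ (*-cancelˡ-< 2 i m x<2m)))
    ... | odd  i rewrite flipParity-odd i  = inj₂ (∈-map⁺ (λ i → (2 * i , suc (2 * i))) (∈-upTo⁺ (half< {i} x<2m)))

    flipParity-< : ∀ {x} → x < 2 * m → flipParity x < 2 * m
    flipParity-< {x} x<2m with parity x
    ... | even i rewrite flipParity-even i = subst (_≤ 2 * m) (2*suc i) (*-monoʳ-≤ 2 (*-cancelˡ-< 2 i m x<2m))
    ... | odd  i rewrite flipParity-odd i  = <-trans (n<1+n (2 * i)) x<2m

    flipParity-≢ : ∀ x → flipParity x ≢ x
    flipParity-≢ (suc (suc x)) e = flipParity-≢ x (suc-injective (suc-injective e))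

    partner : Fin (2 * m) → Fin (2 * m)
    partner i = fromℕ< (flipParity-< (toℕ<n i))

    toℕ-partner : ∀ i → toℕ (partner i) ≡ flipParity (toℕ i)
    toℕ-partner i = toℕ-fromℕ< _

    adj-partner : ∀ i j → adj (H1 m) i j ≡ (j == partner i)
    adj-partner i j = bool-ext adj⇒partner partner⇒adj
      where
      adj⇒partner : adj (H1 m) i j ≡ true → (j == partner i) ≡ true
      adj⇒partner e = subst (λ x → (x == partner i) ≡ true)
        (toℕ-injective (trans (toℕ-partner i) (sym (linked⇒flipParity (any-hit⇒Linked pairs (proj₂ (∧-true e)))))))
        (==-refl (partner i))
      partner⇒adj : (j == partner i) ≡ true → adj (H1 m) i j ≡ true
      partner⇒adj e rewrite trans (cong toℕ (==⇒≡ e)) (toℕ-partner i)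
                          | ≢⇒≡ᵇ-false (flipParity-≢ (toℕ i) ∘ sym)
                          | Linked⇒any-hit pairs (flipParity⇒linked (toℕ<n i)) = refl

  H1-perfectMatching : PerfectMatching (H1 m)
  H1-perfectMatching = record { partner = partner ; adj-partner = adj-partner }

-- The model graphs attain equality

module _ {k H} (E : Fin k → Fin k → Bool) {size} (E-irrefl : ∀ t → E t t ≡ false)
         (B : BlowUp H (undirected E) size) (degree : Fin k → ℕ)
         (degree≡ : ∀ t → sum (λ u → [ undirected E t u ] * size u) ≡ degree t) where
  open BlowUp B
  private
    R-irrefl : ∀ t → undirected E t t ≡ false
    R-irrefl t rewrite E-irrefl t = refl
    open BlowUpDegrees R-irrefl B

    deg≡degree : ∀ i → deg H i ≡ degree (class i)
    deg≡degree i = trans (deg-by-class i) (degree≡ (class i))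

  blowUp-extremal : ∀ s → (∀ t u → E t u ≡ true → s + 2 ≤ degree t + degree u) →
                    ∀ {t u} → E t u ≡ true → 1 ≤ size t → 1 ≤ size u → degree t + degree u ≡ s + 2 →
                    2 * s + sum size ≡ sum (λ t → degree t * size t) → HasEdge H × Extremal H
  blowUp-extremal s arc-bound {t} {u} tu t-inhabited u-inhabited tu≡ total = edge , (begin
    2 * minS1 H + n H                 ≡⟨ cong₂ (λ m v → 2 * m + v) minS1≡s vertices ⟩
    2 * s + sum size                  ≡⟨ total ⟩
    sum (λ t → degree t * size t)     ≡⟨ sum-by-class degree ⟨
    sum (λ j → degree (class j))      ≡⟨ sum-cong-≗ {n H} deg≡degree ⟨
    sum (deg H)                       ≡⟨ handshake H ⟨
    2 * numEdges H                    ∎)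
    where
    open ≡-Reasoning
    lower : ∀ {x y} → adj H x y ≡ true → s + 2 ≤ deg H x + deg H y
    lower {x} {y} xy with ∨-true (proj₂ (∧-true {not (x == y)} (trans (sym (adj-class x y)) xy)))
    ... | inj₁ e = subst (s + 2 ≤_) (sym (cong₂ _+_ (deg≡degree x) (deg≡degree y))) (arc-bound _ _ e)
    ... | inj₂ e = subst (s + 2 ≤_) (sym (trans (+-comm (deg H x) _) (cong₂ _+_ (deg≡degree y) (deg≡degree x)))) (arc-bound _ _ e)
    witness : ∃ λ a → ∃ λ b → adj H a b ≡ true × class a ≡ t × class b ≡ u
    witness = edge-between (cong (_∨ E u t) tu) t-inhabited u-inhabited
    edge : HasEdge H
    edge = let a , b , ab , _ = witness in a , b , ab
    attained : ∀ {a b} → class a ≡ t → class b ≡ u → deg H a + deg H b ≡ s + 2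
    attained ca cb = trans (cong₂ _+_ (trans (deg≡degree _) (cong degree ca)) (trans (deg≡degree _) (cong degree cb))) tu≡
    minS1≡s : minS1 H ≡ s
    minS1≡s = let _ , _ , ab , ca , cb = witness in +-cancelʳ-≡ 2 _ _ (minS1+2≡ H lower ab (attained ca cb))
    vertices : n H ≡ sum size
    vertices = trans (sym (count-true (n H))) (trans (sum-by-class (λ _ → 1)) (sum-cong-≗ {k} (λ t → *-identityˡ (size t))))

twoStarsArc-irrefl : ∀ t → twoStarsArc t t ≡ false
twoStarsArc-irrefl 0F = refl
twoStarsArc-irrefl 1F = refl
twoStarsArc-irrefl 2F = refl
twoStarsArc-irrefl 3F = refl

doubleStarArc-irrefl : ∀ t → doubleStarArc t t ≡ false
doubleStarArc-irrefl 0F = refl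
doubleStarArc-irrefl 1F = refl
doubleStarArc-irrefl 2F = refl
doubleStarArc-irrefl 3F = refl

twoStars-extremal : ∀ k → HasEdge (twoStars (suc k)) × Extremal (twoStars (suc k))
twoStars-extremal k =
  blowUp-extremal twoStarsArc twoStarsArc-irrefl (twoStars-blowUp K) degree degree≡ k arc-bound {0F} {1F} refl ≤-refl (s≤s z≤n) sum₀₁ total
  where
  K = suc k
  degree : Fin 4 → ℕ
  degree 0F = K
  degree 1F = 1
  degree 2F = K
  degree 3F = 1
  degree≡ : ∀ t → sum (λ u → [ undirected twoStarsArc t u ] * blockSize 1 K 1 K u) ≡ degree t
  degree≡ 0F = trans (+-identityʳ _) (+-identityʳ K)
  degree≡ 1F = refl
  degree≡ 2F = trans (+-identityʳ _) (+-identityʳ K)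
  degree≡ 3F = refl
  sum₀₁ : K + 1 ≡ k + 2
  sum₀₁ = sym (+-suc k 1)
  arc-bound : ∀ t u → twoStarsArc t u ≡ true → k + 2 ≤ degree t + degree u
  arc-bound 0F 1F _ = ≤-reflexive (sym sum₀₁)
  arc-bound 2F 3F _ = ≤-reflexive (sym sum₀₁)
  arc-bound 0F 0F ()
  arc-bound 0F 2F ()
  arc-bound 0F 3F ()
  arc-bound 1F _  ()
  arc-bound 2F 0F ()
  arc-bound 2F 1F ()
  arc-bound 2F 2F ()
  arc-bound 3F _  ()
  total : 2 * k + (1 + (K + (1 + (K + 0)))) ≡ K * 1 + (1 * K + (K * 1 + (1 * K + 0)))
  total = lemma k
    where lemma : ∀ k → 2 * k + (1 + (suc k + (1 + (suc k + 0)))) ≡ suc k * 1 + (1 * suc k + (suc k * 1 + (1 * suc k + 0)))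
          lemma = solve-∀

doubleStar-extremal : ∀ b → 1 ≤ b → HasEdge (H4tree (suc b)) × Extremal (H4tree (suc b))
doubleStar-extremal b 1≤b =
  blowUp-extremal doubleStarArc doubleStarArc-irrefl (doubleStar-blowUp b) degree degree≡ b arc-bound {0F} {2F} refl (s≤s z≤n) 1≤b sum₀₂ (total b)
  where
  degree : Fin 4 → ℕ
  degree 0F = b + 1
  degree 1F = 1
  degree 2F = 1
  degree 3F = 1 + b
  degree≡ : ∀ t → sum (λ u → [ undirected doubleStarArc t u ] * blockSize 1 b b 1 u) ≡ degree t
  degree≡ 0F = cong (_+ 1) (+-identityʳ b)
  degree≡ 1F = refl
  degree≡ 2F = refl
  degree≡ 3F = cong suc (trans (+-identityʳ _) (+-identityʳ b))
  sum₀₂ : b + 1 + 1 ≡ b + 2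
  sum₀₂ = +-assoc b 1 1
  arc-bound : ∀ t u → doubleStarArc t u ≡ true → b + 2 ≤ degree t + degree u
  arc-bound 0F 2F _ = ≤-reflexive (sym sum₀₂)
  arc-bound 0F 3F _ = ≤-trans (≤-reflexive (sym sum₀₂)) (+-monoʳ-≤ (b + 1) (s≤s z≤n))
  arc-bound 1F 3F _ = ≤-reflexive (+-comm b 2)
  arc-bound 0F 0F ()
  arc-bound 0F 1F ()
  arc-bound 1F 0F ()
  arc-bound 1F 1F ()
  arc-bound 1F 2F ()
  arc-bound 2F _  ()
  arc-bound 3F _  ()
  total : ∀ b → 2 * b + (1 + (b + (b + (1 + 0)))) ≡ (b + 1) * 1 + (1 * b + (1 * b + ((1 + b) * 1 + 0)))
  total = solve-∀

perfectMatching-extremal : ∀ {H} → PerfectMatching H → Fin (n H) → HasEdge H × Extremal H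
perfectMatching-extremal {H} M i = (i , partner i , edge) , (begin
  2 * minS1 H + n H  ≡⟨ cong (_+ n H) (cong (2 *_) minS1≡0) ⟩
  n H                ≡⟨ count-true (n H) ⟨
  sum {n H} (λ _ → 1) ≡⟨ sum-cong-≗ {n H} deg≡1 ⟨
  sum (deg H)        ≡⟨ handshake H ⟨
  2 * numEdges H     ∎)
  where
  open ≡-Reasoning
  open PerfectMatching M
  deg≡1 : ∀ j → deg H j ≡ 1
  deg≡1 j = trans (sum-cong-≗ {n H} (λ l → cong [_] (adj-partner j l))) (count-singleton (partner j))
  edge : adj H i (partner i) ≡ true
  edge = trans (adj-partner i (partner i)) (==-refl (partner i))
  minS1≡0 : minS1 H ≡ 0
  minS1≡0 = +-cancelʳ-≡ 2 _ _ (minS1+2≡ H (λ {x} {y} _ → ≤-reflexive (sym (cong₂ _+_ (deg≡1 x) (deg≡1 y)))) edge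
                                 (cong₂ _+_ (deg≡1 i) (deg≡1 (partner i))))

Conclusion : Graph → Set
Conclusion G = (G ≅ K22)
             ⊎ (∃ λ m → (2 ≤ m) × (G ≅ H1 m))
             ⊎ (∃ λ m → (2 ≤ m) × (2 ∣ m) × (G ≅ H2 m))
             ⊎ (∃ λ m → (2 ≤ m) × (2 ∣ m) × (G ≅ H3 m))
             ⊎ (∃ λ m → (3 ≤ m) × (¬ (2 ∣ m)) × (G ≅ H4 m))

3≤2*m⇒2≤m : ∀ {m} → 3 ≤ 2 * m → 2 ≤ m
3≤2*m⇒2≤m {suc (suc m)} _ = s≤s (s≤s z≤n)
3≤2*m⇒2≤m {suc zero} (s≤s (s≤s ()))

2*k/2≡k : ∀ k → 2 * k / 2 ≡ k
2*k/2≡k k = trans (cong (_/ 2) (*-comm 2 k)) (m*n/n≡m k 2)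

[1+2*b+1]/2≡1+b : ∀ b → (suc (2 * b) + 1) / 2 ≡ suc b
[1+2*b+1]/2≡1+b b = trans (cong (_/ 2) (lemma b)) (m*n/n≡m (suc b) 2)
  where
  lemma : ∀ b → suc (2 * b) + 1 ≡ suc b * 2
  lemma = solve-∀

¬2∣1+2*b : ∀ b → ¬ (2 ∣ suc (2 * b))
¬2∣1+2*b b 2∣1+2b with () ← ∣1⇒≡1 (∣m+n∣m⇒∣n (subst (2 ∣_) (+-comm 1 (2 * b)) 2∣1+2b) (m∣m*n b))

-- The bound at an edge of minimal degree sum

three-colours : (x y z : Bool) → x ≢ y → y ≢ z → x ≢ z → ⊥
three-colours false false _     x≢y _   _   = x≢y refl
three-colours true  true  _     x≢y _   _   = x≢y refl
three-colours false true  false _   _   x≢z = x≢z refl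
three-colours false true  true  _   y≢z _   = y≢z refl
three-colours true  false false _   y≢z _   = y≢z refl
three-colours true  false true  _   _   x≢z = x≢z refl

module BipartiteWithoutIsolated (G : Graph) (bipartite : IsBipartite G) (noIsolated : NoIsolated G) where

  A : Fin (n G) → Fin (n G) → Bool
  A = adj G

  d : Fin (n G) → ℕ
  d = deg G

  N : ℕ
  N = n G

  adj-flip : ∀ {i j b} → A i j ≡ b → A j i ≡ b
  adj-flip {i} {j} ij = trans (adj-sym G j i) ij

  adj⇒≢ : ∀ {i j} → A i j ≡ true → i ≢ j
  adj⇒≢ {i} ij refl with () ← trans (sym ij) (irrefl G i)

  no-triangle : ∀ {a b c} → A a b ≡ true → A b c ≡ true → A a c ≡ true → ⊥
  no-triangle {a} {b} {c} ab bc ac =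
    three-colours (colour a) (colour b) (colour c) (proper a b ab) (proper b c bc) (proper a c ac)
    where
    colour = proj₁ bipartite
    proper = proj₂ bipartite

  neighbours-non-adjacent : ∀ {u v i} → A u v ≡ true → A u i ≡ true → A v i ≡ false
  neighbours-non-adjacent uv ui = ¬true⇒false (λ vi → no-triangle uv vi ui)

  1≤d : ∀ i → 1 ≤ d i
  1≤d i = 1≤count (A i) (proj₂ (noIsolated i))

  d≡suc-pred : ∀ i → d i ≡ suc (pred (d i))
  d≡suc-pred i = sym (suc-pred (d i) {{>-nonZero (1≤d i)}})

  sum-d≥N : N ≤ sum d
  sum-d≥N = subst (_≤ sum d) (count-true N) (sum-mono-≤ 1≤d)

  only-neighbour : ∀ {i p j} → d i ≡ 1 → A i p ≡ true → A i j ≡ true → j ≡ p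
  only-neighbour {i} {p} {j} di≡1 ip ij with j ≟ p
  ... | yes j≡p = j≡p
  ... | no  j≢p = ⊥-elim (<-irrefl refl (≤-trans (2≤count (A i) ip ij (j≢p ∘ sym)) (≤-reflexive di≡1)))

  two-neighbours : ∀ {i p q j} → d i ≡ 2 → A i p ≡ true → A i q ≡ true → p ≢ q → A i j ≡ true → j ≡ p ⊎ j ≡ q
  two-neighbours {i} {p} {q} {j} di≡2 ip iq p≢q ij with j ≟ p | j ≟ q
  ... | yes j≡p | _       = inj₁ j≡p
  ... | no  _   | yes j≡q = inj₂ j≡q
  ... | no  j≢p | no  j≢q =
    ⊥-elim (<-irrefl refl (≤-trans (3≤count (A i) ip iq ij p≢q (j≢p ∘ sym) (j≢q ∘ sym)) (≤-reflexive di≡2)))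

  other-neighbour : ∀ {i a} → 2 ≤ d i → A i a ≡ true → ∃ λ j → A i j ≡ true × j ≢ a
  other-neighbour {i} {a} 2≤di ia with 1≤count⇒∃ (λ j → A i j ∧ not (j == a)) (≤-pred (≤-trans 2≤di (≤-reflexive (count-remove (A i) a ia))))
  ... | j , e = j , proj₁ (∧-true e) , ==false⇒≢ (Bool.not-injective (proj₂ (∧-true e)))

  count-other-neighbours : ∀ {u v} → A u v ≡ true → suc (count (λ i → A u i ∧ not (i == v))) ≡ d u
  count-other-neighbours uv = sym (count-remove (A _) _ uv)

  DegreeSumMinimal : Fin (n G) → Fin (n G) → Set
  DegreeSumMinimal u v = ∀ {x y} → A x y ≡ true → d u + d v ≤ d x + d y

  EdgeAvoiding : Fin (n G) → Set
  EdgeAvoiding w = ∃ λ x → ∃ λ y → A x y ≡ true × x ≢ w × y ≢ w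

  record K22Shape : Set where
    field
      corner           : Fin 4 → Fin N
      corner-adj       : ∀ s t → A (corner s) (corner t) ≡ adj K22 s t
      corner-injective : ∀ {s t} → corner s ≡ corner t → s ≡ t
      corner-onto      : ∀ i → ∃ λ t → corner t ≡ i

  record TwoCentres (linked : Bool) (ℓ : ℕ) : Set where
    field
      c₁ c₂   : Fin N
      c₁≢c₂   : c₁ ≢ c₂
      centres : A c₁ c₂ ≡ linked
      cover   : ∀ i → i ≡ c₁ ⊎ i ≡ c₂ ⊎ A c₁ i ≡ true ⊎ A c₂ i ≡ true
      leaf    : ∀ i → i ≢ c₁ → i ≢ c₂ → d i ≡ 1
      leaves₁ : count (λ i → A c₁ i ∧ not (i == c₂)) ≡ ℓ
      leaves₂ : count (λ i → A c₂ i ∧ not (i == c₁)) ≡ ℓ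

  Shape : Set
  Shape = K22Shape
        ⊎ ((∀ i → d i ≡ 1) × 3 ≤ N)
        ⊎ (∃ λ k → 1 ≤ k × TwoCentres false k)
        ⊎ (∃ λ b → 1 ≤ b × TwoCentres true b)

  -- Minimality forbids an edge between two vertices of degree 1.
  covered-by-centres : ∀ {u v c₁ c₂} → DegreeSumMinimal u v → 3 ≤ d u + d v → (∀ i → i ≢ c₁ → i ≢ c₂ → d i ≡ 1) →
                       ∀ i → i ≡ c₁ ⊎ i ≡ c₂ ⊎ A c₁ i ≡ true ⊎ A c₂ i ≡ true
  covered-by-centres {c₁ = c₁} {c₂} minimal 3≤ leaf i with i ≟ c₁ | i ≟ c₂
  ... | yes i≡c₁ | _        = inj₁ i≡c₁
  ... | no _     | yes i≡c₂ = inj₂ (inj₁ i≡c₂)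
  ... | no i≢c₁  | no i≢c₂  = via (noIsolated i)
    where
    via : (∃ λ j → A i j ≡ true) → i ≡ c₁ ⊎ i ≡ c₂ ⊎ A c₁ i ≡ true ⊎ A c₂ i ≡ true
    via (j , ij) with j ≟ c₁ | j ≟ c₂
    ... | yes refl | _        = inj₂ (inj₂ (inj₁ (adj-flip ij)))
    ... | no _     | yes refl = inj₂ (inj₂ (inj₂ (adj-flip ij)))
    ... | no j≢c₁  | no j≢c₂  = ⊥-elim (<-irrefl refl (≤-trans 3≤ (subst₂ (λ p q → _ ≤ p + q) (leaf i i≢c₁ i≢c₂) (leaf j j≢c₁ j≢c₂) (minimal ij))))

  count-without : ∀ {c a} → A c a ≡ false → count (λ i → A c i ∧ not (i == a)) ≡ d c
  count-without {c} {a} ca = sum-cong-≗ {N} λ i → cong [_] (pointwise i)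
    where
    pointwise : ∀ i → A c i ∧ not (i == a) ≡ A c i
    pointwise i with i ≟ a
    ... | yes refl = trans (∧-zeroʳ _) (sym ca)
    ... | no _     = ∧-identityʳ _

  twoStarsShape : ∀ {u v c₁ c₂ k} → DegreeSumMinimal u v → 3 ≤ d u + d v → c₁ ≢ c₂ → A c₁ c₂ ≡ false →
                  d c₁ ≡ k → d c₂ ≡ k → (∀ i → i ≢ c₁ → i ≢ c₂ → d i ≡ 1) → TwoCentres false k
  twoStarsShape {c₁ = c₁} {c₂} minimal 3≤ c₁≢c₂ c₁c₂ dc₁ dc₂ leaf = record
    { c₁ = c₁ ; c₂ = c₂ ; c₁≢c₂ = c₁≢c₂ ; centres = c₁c₂ ; cover = covered-by-centres minimal 3≤ leaf ; leaf = leaf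
    ; leaves₁ = trans (count-without c₁c₂) dc₁ ; leaves₂ = trans (count-without (adj-flip c₁c₂)) dc₂ }

  doubleStarShape : ∀ {u v c₁ c₂ b} → DegreeSumMinimal u v → 3 ≤ d u + d v → A c₁ c₂ ≡ true →
                    d c₁ ≡ suc b → d c₂ ≡ suc b → (∀ i → i ≢ c₁ → i ≢ c₂ → d i ≡ 1) → TwoCentres true b
  doubleStarShape {c₁ = c₁} {c₂} minimal 3≤ c₁c₂ dc₁ dc₂ leaf = record
    { c₁ = c₁ ; c₂ = c₂ ; c₁≢c₂ = adj⇒≢ c₁c₂ ; centres = c₁c₂ ; cover = covered-by-centres minimal 3≤ leaf ; leaf = leaf
    ; leaves₁ = suc-injective (trans (count-other-neighbours c₁c₂) dc₁)
    ; leaves₂ = suc-injective (trans (count-other-neighbours (adj-flip c₁c₂)) dc₂) }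

  -- g bounds the degrees from below: at u and v, at the other neighbours of u (degree ≥ d v by
  -- minimality) and at the other neighbours of v (degree ≥ d u), which are distinct as G has no triangles.
  module CaseA {u v : Fin N} {a b : ℕ} (uv : A u v ≡ true) (minimal : DegreeSumMinimal u v)
               (du : d u ≡ suc a) (dv : d v ≡ suc b) (1≤a : 1 ≤ a) (1≤b : 1 ≤ b) where

    otherᵘ otherᵛ : Fin N → Bool
    otherᵘ i = A u i ∧ not (i == v)
    otherᵛ i = A v i ∧ not (i == u)

    g : Fin N → ℕ
    g i = 1 + ((if i == u then a else 0) + ((if i == v then b else 0) + ((if otherᵘ i then b else 0) + (if otherᵛ i then a else 0))))

    u≢v : u ≢ v
    u≢v = adj⇒≢ uv

    data Position (i : Fin N) : Set where
      at-u   : i ≡ u → Position i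
      at-v   : i ≡ v → Position i
      near-u : A u i ≡ true → i ≢ v → Position i
      near-v : A v i ≡ true → i ≢ u → Position i
      far    : i ≢ u → i ≢ v → A u i ≡ false → A v i ≡ false → Position i

    position : ∀ i → Position i
    position i with i ≟ u | i ≟ v | A u i in ui | A v i in vi
    ... | yes i≡u | _       | _     | _     = at-u i≡u
    ... | no _    | yes i≡v | _     | _     = at-v i≡v
    ... | no _    | no i≢v  | true  | _     = near-u ui i≢v
    ... | no i≢u  | no _    | false | true  = near-v vi i≢u
    ... | no i≢u  | no i≢v  | false | false = far i≢u i≢v ui vi

    g-u : g u ≡ suc a
    g-u rewrite ==-refl u | ≢⇒==false u≢v | irrefl G u | ∧-zeroʳ (A v u) = cong suc (+-identityʳ a)

    g-v : g v ≡ suc b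
    g-v rewrite ==-refl v | ≢⇒==false (u≢v ∘ sym) | irrefl G v | ∧-zeroʳ (A u v) = cong suc (+-identityʳ b)

    g-near-u : ∀ {i} → A u i ≡ true → i ≢ v → g i ≡ suc b
    g-near-u {i} ui i≢v rewrite ≢⇒==false (adj⇒≢ ui ∘ sym) | ≢⇒==false i≢v | ui | neighbours-non-adjacent uv ui =
      cong suc (+-identityʳ b)

    g-near-v : ∀ {i} → A v i ≡ true → i ≢ u → g i ≡ suc a
    g-near-v {i} vi i≢u rewrite ≢⇒==false i≢u | ≢⇒==false (adj⇒≢ vi ∘ sym) | vi | neighbours-non-adjacent (adj-flip uv) vi = refl

    g-far : ∀ {i} → i ≢ u → i ≢ v → A u i ≡ false → A v i ≡ false → g i ≡ 1
    g-far i≢u i≢v ui vi rewrite ≢⇒==false i≢u | ≢⇒==false i≢v | ui | vi = refl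

    g≤d : ∀ i → g i ≤ d i
    g≤d i with position i
    ... | at-u refl = ≤-reflexive (trans g-u (sym du))
    ... | at-v refl = ≤-reflexive (trans g-v (sym dv))
    ... | near-u ui i≢v = subst (_≤ d i) (sym (g-near-u ui i≢v)) (subst (_≤ d i) dv (+-cancelˡ-≤ (d u) _ _ (minimal ui)))
    ... | near-v vi i≢u = subst (_≤ d i) (sym (g-near-v vi i≢u))
                            (subst (_≤ d i) du (+-cancelˡ-≤ (d v) _ _ (subst (_≤ d v + d i) (+-comm (d u) (d v)) (minimal vi))))
    ... | far i≢u i≢v ui vi = subst (_≤ d i) (sym (g-far i≢u i≢v ui vi)) (1≤d i)

    count-otherᵘ : count otherᵘ ≡ a
    count-otherᵘ = suc-injective (trans (count-other-neighbours uv) du)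

    count-otherᵛ : count otherᵛ ≡ b
    count-otherᵛ = suc-injective (trans (count-other-neighbours (adj-flip uv)) dv)

    sum-g : sum g ≡ N + (a + (b + (a * b + b * a)))
    sum-g = begin
      sum g
        ≡⟨ ∑-distrib-+ (λ _ → 1) (λ i → f₁ i + (f₂ i + (f₃ i + f₄ i))) ⟩
      sum {N} (λ _ → 1) + sum (λ i → f₁ i + (f₂ i + (f₃ i + f₄ i)))
        ≡⟨ cong₂ _+_ (count-true N) (trans (∑-distrib-+ f₁ _) (cong₂ _+_ (sum-if-== u a)
             (trans (∑-distrib-+ f₂ _) (cong₂ _+_ (sum-if-== v b) (∑-distrib-+ f₃ f₄))))) ⟩
      N + (a + (b + (sum f₃ + sum f₄)))
        ≡⟨ cong (λ s → N + (a + (b + s))) (cong₂ _+_ (trans (sum-if otherᵘ b) (cong (_* b) count-otherᵘ))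
                                                      (trans (sum-if otherᵛ a) (cong (_* a) count-otherᵛ))) ⟩
      N + (a + (b + (a * b + b * a)))  ∎
      where
      open ≡-Reasoning
      f₁ f₂ f₃ f₄ : Fin N → ℕ
      f₁ i = if i == u then a else 0
      f₂ i = if i == v then b else 0
      f₃ i = if otherᵘ i then b else 0
      f₄ i = if otherᵛ i then a else 0

    a+b≤ab+ba : a + b ≤ a * b + b * a
    a+b≤ab+ba = +-mono-≤ (subst (_≤ a * b) (*-identityʳ a) (*-monoʳ-≤ a 1≤b))
                         (subst (_≤ b * a) (*-identityʳ b) (*-monoʳ-≤ b 1≤a))

    2[a+b]+N≤sum-g : 2 * (a + b) + N ≤ sum g
    2[a+b]+N≤sum-g = begin
      2 * (a + b) + N                ≡⟨ lemma a b N ⟩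
      N + (a + (b + (a + b)))        ≤⟨ +-monoʳ-≤ N (+-monoʳ-≤ a (+-monoʳ-≤ b a+b≤ab+ba)) ⟩
      N + (a + (b + (a * b + b * a))) ≡⟨ sum-g ⟨
      sum g                          ∎
      where
      open ≤-Reasoning
      lemma : ∀ a b N → 2 * (a + b) + N ≡ N + (a + (b + (a + b)))
      lemma = solve-∀

    bound : 2 * (a + b) + N ≤ sum d
    bound = ≤-trans 2[a+b]+N≤sum-g (sum-mono-≤ g≤d)

    module Tight (tight : 2 * (a + b) + N ≡ sum d) where

      sum-d≤sum-g : sum d ≤ sum g
      sum-d≤sum-g = ≤-trans (≤-reflexive (sym tight)) 2[a+b]+N≤sum-g

      g≡d : ∀ i → g i ≡ d i
      g≡d = sum-mono-≤-tight g≤d sum-d≤sum-g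

      a≡1×b≡1 : a ≡ 1 × b ≡ 1
      a≡1×b≡1 = ab+ba≤a+b⇒≡1 1≤a 1≤b (+-cancelˡ-≤ b _ _ (+-cancelˡ-≤ a _ _ (+-cancelˡ-≤ N _ _ (begin
        N + (a + (b + (a * b + b * a))) ≡⟨ sum-g ⟨
        sum g                          ≤⟨ sum-mono-≤ g≤d ⟩
        sum d                          ≡⟨ tight ⟨
        2 * (a + b) + N                ≡⟨ lemma a b N ⟩
        N + (a + (b + (a + b)))        ∎))))
        where
        open ≤-Reasoning
        lemma : ∀ a b N → 2 * (a + b) + N ≡ N + (a + (b + (a + b)))
        lemma = solve-∀

      du≡2 : d u ≡ 2
      du≡2 = trans du (cong suc (proj₁ a≡1×b≡1))

      dv≡2 : d v ≡ 2
      dv≡2 = trans dv (cong suc (proj₂ a≡1×b≡1))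

      d-near-u : ∀ {i} → A u i ≡ true → i ≢ v → d i ≡ 2
      d-near-u ui i≢v = trans (sym (g≡d _)) (trans (g-near-u ui i≢v) (cong suc (proj₂ a≡1×b≡1)))

      d-near-v : ∀ {i} → A v i ≡ true → i ≢ u → d i ≡ 2
      d-near-v vi i≢u = trans (sym (g≡d _)) (trans (g-near-v vi i≢u) (cong suc (proj₁ a≡1×b≡1)))

      d≤2 : ∀ i → d i ≤ 2
      d≤2 i with position i
      ... | at-u refl          = ≤-reflexive du≡2
      ... | at-v refl          = ≤-reflexive dv≡2
      ... | near-u ui i≢v      = ≤-reflexive (d-near-u ui i≢v)
      ... | near-v vi i≢u      = ≤-reflexive (d-near-v vi i≢u)
      ... | far i≢u i≢v ui vi  = ≤-trans (≤-reflexive (trans (sym (g≡d i)) (g-far i≢u i≢v ui vi))) (s≤s z≤n)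

      -- a far vertex has degree 1, so minimality would give its neighbour degree 3
      no-far-vertex : ∀ {i} → i ≢ u → i ≢ v → A u i ≡ false → A v i ≡ false → ⊥
      no-far-vertex {i} i≢u i≢v ui vi = <-irrefl refl (≤-trans 3≤dj (≤-trans (d≤2 j) (s≤s (s≤s z≤n))))
        where
        j = proj₁ (noIsolated i)
        3≤dj : 3 ≤ d j
        3≤dj = +-cancelˡ-≤ 1 3 (d j)
          (subst₂ (λ p q → p ≤ q + d j) (cong₂ _+_ du≡2 dv≡2) (trans (sym (g≡d i)) (g-far i≢u i≢v ui vi))
                  (minimal (proj₂ (noIsolated i))))

      module _ {w z : Fin N} (uw : A u w ≡ true) (w≢v : w ≢ v) (vz : A v z ≡ true) (z≢u : z ≢ u) where

        neighbours-u : ∀ {j} → A u j ≡ true → j ≡ v ⊎ j ≡ w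
        neighbours-u = two-neighbours du≡2 uv uw (w≢v ∘ sym)

        neighbours-v : ∀ {j} → A v j ≡ true → j ≡ u ⊎ j ≡ z
        neighbours-v = two-neighbours dv≡2 (adj-flip uv) vz (z≢u ∘ sym)

        vw : A v w ≡ false
        vw = neighbours-non-adjacent uv uw

        uz : A u z ≡ false
        uz = neighbours-non-adjacent (adj-flip uv) vz

        wz : A w z ≡ true
        wz = via (other-neighbour (≤-reflexive (sym (d-near-u uw w≢v))) (adj-flip uw))
          where
          via : (∃ λ t → A w t ≡ true × t ≢ u) → A w z ≡ true
          via (t , wt , t≢u) with position t
          ... | at-u t≡u        = ⊥-elim (t≢u t≡u)
          ... | at-v refl       = ⊥-elim (false≢true (trans (sym vw) (adj-flip wt)))
          ... | far _ t≢v ut vt = ⊥-elim (no-far-vertex t≢u t≢v ut vt)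
          ... | near-u ut t≢v with neighbours-u ut
          ...   | inj₁ t≡v  = ⊥-elim (t≢v t≡v)
          ...   | inj₂ refl = ⊥-elim (adj⇒≢ wt refl)
          via (t , wt , t≢u) | near-v vt _ with neighbours-v vt
          ...   | inj₁ t≡u  = ⊥-elim (t≢u t≡u)
          ...   | inj₂ refl = wt

        corner : Fin 4 → Fin N
        corner 0F = u
        corner 1F = z
        corner 2F = v
        corner 3F = w

        corner-adj : ∀ s t → A (corner s) (corner t) ≡ adj K22 s t
        corner-adj 0F 0F = irrefl G u
        corner-adj 0F 1F = uz
        corner-adj 0F 2F = uv
        corner-adj 0F 3F = uw
        corner-adj 1F 0F = adj-flip uz
        corner-adj 1F 1F = irrefl G z
        corner-adj 1F 2F = adj-flip vz
        corner-adj 1F 3F = adj-flip wz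
        corner-adj 2F 0F = adj-flip uv
        corner-adj 2F 1F = vz
        corner-adj 2F 2F = irrefl G v
        corner-adj 2F 3F = vw
        corner-adj 3F 0F = adj-flip uw
        corner-adj 3F 1F = wz
        corner-adj 3F 2F = adj-flip vw
        corner-adj 3F 3F = irrefl G w

        same-corner : ∀ {s t} → corner s ≡ corner t → adj K22 s t ≡ false
        same-corner {s} {t} e = trans (sym (corner-adj s t)) (subst (λ x → A (corner s) x ≡ false) e (irrefl G (corner s)))

        corner-injective : ∀ {s t} → corner s ≡ corner t → s ≡ t
        corner-injective {0F} {0F} _ = refl
        corner-injective {1F} {1F} _ = refl
        corner-injective {2F} {2F} _ = refl
        corner-injective {3F} {3F} _ = refl
        corner-injective {0F} {1F} e = ⊥-elim (z≢u (sym e))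
        corner-injective {1F} {0F} e = ⊥-elim (z≢u e)
        corner-injective {2F} {3F} e = ⊥-elim (w≢v (sym e))
        corner-injective {3F} {2F} e = ⊥-elim (w≢v e)
        corner-injective {0F} {2F} e = ⊥-elim (false≢true (sym (same-corner e)))
        corner-injective {0F} {3F} e = ⊥-elim (false≢true (sym (same-corner e)))
        corner-injective {1F} {2F} e = ⊥-elim (false≢true (sym (same-corner e)))
        corner-injective {1F} {3F} e = ⊥-elim (false≢true (sym (same-corner e)))
        corner-injective {2F} {0F} e = ⊥-elim (false≢true (sym (same-corner e)))
        corner-injective {2F} {1F} e = ⊥-elim (false≢true (sym (same-corner e)))
        corner-injective {3F} {0F} e = ⊥-elim (false≢true (sym (same-corner e)))
        corner-injective {3F} {1F} e = ⊥-elim (false≢true (sym (same-corner e)))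

        corner-onto : ∀ i → ∃ λ t → corner t ≡ i
        corner-onto i with position i
        ... | at-u i≡u          = 0F , sym i≡u
        ... | at-v i≡v          = 2F , sym i≡v
        ... | far i≢u i≢v ui vi = ⊥-elim (no-far-vertex i≢u i≢v ui vi)
        ... | near-u ui i≢v with neighbours-u ui
        ...   | inj₁ i≡v = ⊥-elim (i≢v i≡v)
        ...   | inj₂ i≡w = 3F , sym i≡w
        corner-onto i | near-v vi i≢u with neighbours-v vi
        ...   | inj₁ i≡u = ⊥-elim (i≢u i≡u)
        ...   | inj₂ i≡z = 1F , sym i≡z

        k22 : K22Shape
        k22 = record { corner = corner ; corner-adj = corner-adj ; corner-injective = corner-injective ; corner-onto = corner-onto }

      k22-shape : K22Shape
      k22-shape = build (other-neighbour (≤-reflexive (sym du≡2)) uv) (other-neighbour (≤-reflexive (sym dv≡2)) (adj-flip uv))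
        where
        build : (∃ λ w → A u w ≡ true × w ≢ v) → (∃ λ z → A v z ≡ true × z ≢ u) → K22Shape
        build (w , uw , w≢v) (z , vz , z≢u) = k22 uw w≢v vz z≢u

  -- With d u = 1 the neighbours of v give nothing; instead the edge xy, which avoids v, carries
  -- excess b by minimality.
  module CaseB {u v x y : Fin N} {b px py : ℕ} (uv : A u v ≡ true) (minimal : DegreeSumMinimal u v)
               (du : d u ≡ 1) (dv : d v ≡ suc b) (1≤b : 1 ≤ b)
               (xy : A x y ≡ true) (x≢v : x ≢ v) (y≢v : y ≢ v) (vy : A v y ≡ false)
               (dx : d x ≡ suc px) (dy : d y ≡ suc py) where

    g : Fin N → ℕ
    g i = 1 + ((if i == v then b else 0) + ((if i == x then px else 0) + (if i == y then py else 0)))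

    x≢y : x ≢ y
    x≢y = adj⇒≢ xy

    g-v : g v ≡ d v
    g-v rewrite ==-refl v | ≢⇒==false (x≢v ∘ sym) | ≢⇒==false (y≢v ∘ sym) = trans (cong suc (+-identityʳ b)) (sym dv)

    g-x : g x ≡ d x
    g-x rewrite ==-refl x | ≢⇒==false x≢v | ≢⇒==false x≢y = trans (cong suc (+-identityʳ px)) (sym dx)

    g-y : g y ≡ d y
    g-y rewrite ==-refl y | ≢⇒==false y≢v | ≢⇒==false (x≢y ∘ sym) = sym dy

    g-other : ∀ {i} → i ≢ v → i ≢ x → i ≢ y → g i ≡ 1
    g-other i≢v i≢x i≢y rewrite ≢⇒==false i≢v | ≢⇒==false i≢x | ≢⇒==false i≢y = refl

    data Position (i : Fin N) : Set where
      at-v      : i ≡ v → Position i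
      at-x      : i ≡ x → Position i
      at-y      : i ≡ y → Position i
      elsewhere : i ≢ v → i ≢ x → i ≢ y → Position i

    position : ∀ i → Position i
    position i with i ≟ v | i ≟ x | i ≟ y
    ... | yes i≡v | _       | _       = at-v i≡v
    ... | no _    | yes i≡x | _       = at-x i≡x
    ... | no _    | no _    | yes i≡y = at-y i≡y
    ... | no i≢v  | no i≢x  | no i≢y  = elsewhere i≢v i≢x i≢y

    g≤d : ∀ i → g i ≤ d i
    g≤d i with position i
    ... | at-v refl = ≤-reflexive g-v
    ... | at-x refl = ≤-reflexive g-x
    ... | at-y refl = ≤-reflexive g-y
    ... | elsewhere i≢v i≢x i≢y = subst (_≤ d i) (sym (g-other i≢v i≢x i≢y)) (1≤d i)

    sum-g : sum g ≡ N + (b + (px + py))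
    sum-g = begin
      sum g
        ≡⟨ ∑-distrib-+ (λ _ → 1) (λ i → f₁ i + (f₂ i + f₃ i)) ⟩
      sum {N} (λ _ → 1) + sum (λ i → f₁ i + (f₂ i + f₃ i))
        ≡⟨ cong₂ _+_ (count-true N) (trans (∑-distrib-+ f₁ _) (cong₂ _+_ (sum-if-== v b)
             (trans (∑-distrib-+ f₂ f₃) (cong₂ _+_ (sum-if-== x px) (sum-if-== y py))))) ⟩
      N + (b + (px + py))  ∎
      where
      open ≡-Reasoning
      f₁ f₂ f₃ : Fin N → ℕ
      f₁ i = if i == v then b else 0
      f₂ i = if i == x then px else 0
      f₃ i = if i == y then py else 0

    b≤px+py : b ≤ px + py
    b≤px+py = ≤-pred (+-cancelˡ-≤ 1 _ _ (subst₂ _≤_ (cong₂ _+_ du dv) (trans (cong₂ _+_ dx dy) (cong suc (+-suc px py))) (minimal xy)))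

    2b+N≤sum-g : 2 * (0 + b) + N ≤ sum g
    2b+N≤sum-g = begin
      2 * (0 + b) + N     ≡⟨ lemma b N ⟩
      N + (b + b)         ≤⟨ +-monoʳ-≤ N (+-monoʳ-≤ b b≤px+py) ⟩
      N + (b + (px + py)) ≡⟨ sum-g ⟨
      sum g               ∎
      where
      open ≤-Reasoning
      lemma : ∀ b N → 2 * (0 + b) + N ≡ N + (b + b)
      lemma = solve-∀

    bound : 2 * (0 + b) + N ≤ sum d
    bound = ≤-trans 2b+N≤sum-g (sum-mono-≤ g≤d)

    module Tight (tight : 2 * (0 + b) + N ≡ sum d) where

      g≡d : ∀ i → g i ≡ d i
      g≡d = sum-mono-≤-tight g≤d (≤-trans (≤-reflexive (sym tight)) 2b+N≤sum-g)

      px+py≡b : px + py ≡ b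
      px+py≡b = ≤-antisym (+-cancelˡ-≤ b _ _ (+-cancelˡ-≤ N _ _ (begin
        N + (b + (px + py)) ≡⟨ sum-g ⟨
        sum g               ≤⟨ sum-mono-≤ g≤d ⟩
        sum d               ≡⟨ tight ⟨
        2 * (0 + b) + N     ≡⟨ lemma b N ⟩
        N + (b + b)         ∎))) b≤px+py
        where
        open ≤-Reasoning
        lemma : ∀ b N → 2 * (0 + b) + N ≡ N + (b + b)
        lemma = solve-∀

      d-elsewhere : ∀ {i} → i ≢ v → i ≢ x → i ≢ y → d i ≡ 1
      d-elsewhere i≢v i≢x i≢y = trans (sym (g≡d _)) (g-other i≢v i≢x i≢y)

      3≤du+dv : 3 ≤ d u + d v
      3≤du+dv = subst (3 ≤_) (sym (cong₂ _+_ du dv)) (s≤s (s≤s 1≤b))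

      -- a second neighbour l of p is a leaf, so minimality at pl bounds d p
      heavy : ∀ {p q} → A p q ≡ true → A v p ≡ false → (∀ {l} → l ≢ v → l ≢ p → l ≢ q → d l ≡ 1) → 2 ≤ d p → suc b ≤ d p
      heavy {p} {q} pq vp rest 2≤dp = via (other-neighbour 2≤dp pq)
        where
        via : (∃ λ l → A p l ≡ true × l ≢ q) → suc b ≤ d p
        via (l , pl , l≢q) = +-cancelʳ-≤ 1 _ _
          (subst₂ _≤_ (trans (cong₂ _+_ du dv) (+-comm 1 (suc b))) (cong (d p +_) (rest l≢v (adj⇒≢ pl ∘ sym) l≢q)) (minimal pl))
          where
          l≢v : l ≢ v
          l≢v refl = false≢true (trans (sym vp) (adj-flip pl))

      leaf-but-x : d x ≡ 1 → ∀ i → i ≢ v → i ≢ y → d i ≡ 1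
      leaf-but-x dx≡1 i i≢v i≢y with i ≟ x
      ... | yes refl = dx≡1
      ... | no i≢x   = d-elsewhere i≢v i≢x i≢y

      leaf-but-y : d y ≡ 1 → ∀ i → i ≢ v → i ≢ x → d i ≡ 1
      leaf-but-y dy≡1 i i≢v i≢x with i ≟ y
      ... | yes refl = dy≡1
      ... | no i≢y   = d-elsewhere i≢v i≢x i≢y

      px≡b⇐py≡0 : py ≡ 0 → px ≡ b
      px≡b⇐py≡0 py≡0 = trans (sym (+-identityʳ px)) (trans (cong (px +_) (sym py≡0)) px+py≡b)

      centred-at-v-x : A v x ≡ true → TwoCentres true b
      centred-at-v-x vx = doubleStarShape minimal 3≤du+dv vx dv (trans dx (cong suc (px≡b⇐py≡0 py≡0))) (leaf-but-y dy≡1)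
        where
        -- a heavy y would take all of the excess b, leaving x, a neighbour of both v and y, with degree 1
        y-light : ¬ (2 ≤ d y)
        y-light 2≤dy = <-irrefl refl (≤-trans (2≤count (A x) (adj-flip vx) xy (y≢v ∘ sym)) (≤-reflexive dx≡1))
          where
          b≤py : b ≤ py
          b≤py = ≤-pred (subst (suc b ≤_) dy (heavy (adj-flip xy) vy (λ l≢v l≢y l≢x → d-elsewhere l≢v l≢x l≢y) 2≤dy))
          dx≡1 : d x ≡ 1
          dx≡1 = trans dx (cong suc (m+n≡o⇒o≤n⇒m≡0 px+py≡b b≤py))
        dy≡1 : d y ≡ 1
        dy≡1 = ≤-antisym (≤-pred (≰⇒> y-light)) (1≤d y)
        py≡0 : py ≡ 0
        py≡0 = suc-injective (trans (sym dy) dy≡1)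

      centred-at-v : A v x ≡ false → TwoCentres false (suc b)
      centred-at-v vx with 2 ≤? d x
      ... | no x-light = twoStarsShape minimal 3≤du+dv (y≢v ∘ sym) vy dv (trans dy (cong suc py≡b)) (leaf-but-x dx≡1)
        where
        dx≡1 : d x ≡ 1
        dx≡1 = ≤-antisym (≤-pred (≰⇒> x-light)) (1≤d x)
        py≡b : py ≡ b
        py≡b = trans (cong (_+ py) (sym (suc-injective (trans (sym dx) dx≡1)))) px+py≡b
      ... | yes 2≤dx = twoStarsShape minimal 3≤du+dv (x≢v ∘ sym) vx dv (trans dx (cong suc (px≡b⇐py≡0 py≡0))) (leaf-but-y dy≡1)
        where
        b≤px : b ≤ px
        b≤px = ≤-pred (subst (suc b ≤_) dx (heavy xy vx d-elsewhere 2≤dx))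
        py≡0 : py ≡ 0
        py≡0 = m+n≡o⇒o≤n⇒m≡0 (trans (+-comm py px) px+py≡b) b≤px
        dy≡1 : d y ≡ 1
        dy≡1 = trans dy (cong suc py≡0)

      shape : Shape
      shape with A v x in vx
      ... | true  = inj₂ (inj₂ (inj₂ (b , 1≤b , centred-at-v-x vx)))
      ... | false = inj₂ (inj₂ (inj₁ (suc b , s≤s z≤n , centred-at-v vx)))

  Bound : ℕ → Set
  Bound m = (2 * m + N ≤ sum d) × (2 * m + N ≡ sum d → Shape)

  minimal-flip : ∀ {u v} → DegreeSumMinimal u v → DegreeSumMinimal v u
  minimal-flip {u} {v} minimal {x} {y} xy = subst (_≤ d x + d y) (+-comm (d u) (d v)) (minimal xy)

  avoiding-non-neighbour : ∀ {v} → EdgeAvoiding v → ∃ λ x → ∃ λ y → A x y ≡ true × x ≢ v × y ≢ v × A v y ≡ false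
  avoiding-non-neighbour {v} (x , y , xy , x≢v , y≢v) with A v y in vy
  ... | false = x , y , xy , x≢v , y≢v , vy
  ... | true  = y , x , adj-flip xy , y≢v , x≢v , ¬true⇒false (λ vx → no-triangle vx xy vy)

  bound-matching : ∀ {u} → EdgeAvoiding u → Bound 0
  bound-matching {u} (x , y , xy , x≢u , y≢u) = sum-d≥N , λ tight → inj₂ (inj₁ (all-one tight , 3≤N))
    where
    all-one : N ≡ sum d → ∀ i → d i ≡ 1
    all-one tight i = sym (sum-mono-≤-tight 1≤d (≤-trans (≤-reflexive (sym tight)) (≤-reflexive (sym (count-true N)))) i)
    3≤N : 3 ≤ N
    3≤N = subst (3 ≤_) (count-true N) (3≤count (λ _ → true) {u} {x} {y} refl refl refl (x≢u ∘ sym) (y≢u ∘ sym) (adj⇒≢ xy))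

  bound-one-leaf : ∀ {u v b} → A u v ≡ true → DegreeSumMinimal u v → d u ≡ 1 → d v ≡ suc b → 1 ≤ b → EdgeAvoiding v → Bound (0 + b)
  bound-one-leaf {u} {v} uv minimal du dv 1≤b avoid with avoiding-non-neighbour avoid
  ... | x , y , xy , x≢v , y≢v , vy = B.bound , λ tight → B.Tight.shape tight
    where
    module B = CaseB uv minimal du dv 1≤b xy x≢v y≢v vy (d≡suc-pred x) (d≡suc-pred y)

  bound : ∀ {u v} a b → A u v ≡ true → DegreeSumMinimal u v → (∀ w → EdgeAvoiding w) →
          d u ≡ suc a → d v ≡ suc b → Bound (a + b)
  bound {u} {v} zero    zero    uv minimal avoid du dv = bound-matching (avoid u)
  bound {u} {v} zero    (suc b) uv minimal avoid du dv = bound-one-leaf uv minimal du dv (s≤s z≤n) (avoid v)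
  bound {u} {v} (suc a) zero    uv minimal avoid du dv =
    subst Bound (+-comm 0 (suc a)) (bound-one-leaf (adj-flip uv) (minimal-flip minimal) dv du (s≤s z≤n) (avoid u))
  bound (suc a) (suc b) uv minimal avoid du dv = A.bound , λ tight → inj₁ (A.Tight.k22-shape tight)
    where
    module A = CaseA uv minimal du dv (s≤s z≤n) (s≤s z≤n)

  blowUp-of : ∀ {k} {R : Fin k → Fin k → Bool} {size} (class : Fin N → Fin k) →
              (∀ i j → A i j ≡ R (class i) (class j)) → (∀ t → count (λ i → class i == t) ≡ size t) → BlowUp G R size
  blowUp-of {R = R} class adj≡R sizes = record { class = class ; adj-class = adj-class ; class-size = sizes }
    where
    adj-class : ∀ i j → A i j ≡ (not (i == j) ∧ R (class i) (class j))
    adj-class i j with i ≟ j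
    ... | yes refl = irrefl G i
    ... | no _     = adj≡R i j

  module NoEdgeAvoiding (w : Fin N) (no-avoiding : ¬ EdgeAvoiding w) where

    class : Fin N → Fin 4
    class i = if i == w then 0F else 1F

    adj-w : ∀ {j} → j ≢ w → A w j ≡ true
    adj-w {j} j≢w = via (noIsolated j)
      where
      via : (∃ λ k → A j k ≡ true) → A w j ≡ true
      via (k , jk) with k ≟ w
      ... | yes refl = adj-flip jk
      ... | no k≢w   = ⊥-elim (no-avoiding (j , k , jk , j≢w , k≢w))

    adj≡pattern : ∀ i j → A i j ≡ undirected twoStarsArc (class i) (class j)
    adj≡pattern i j with i ≟ w | j ≟ w
    ... | yes refl | yes refl = irrefl G w
    ... | yes refl | no j≢w   = adj-w j≢w
    ... | no i≢w   | yes refl = adj-flip (adj-w i≢w)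
    ... | no i≢w   | no j≢w   = ¬true⇒false (λ ij → no-avoiding (i , j , ij , i≢w , j≢w))

    count-others : count (λ i → not (i == w)) ≡ N ∸ 1
    count-others = sym (begin
      N ∸ 1                                            ≡⟨ cong (_∸ 1) (trans (sym (count-true N)) (count-split (λ _ → true) (_== w))) ⟩
      (count (_== w) + count (λ i → not (i == w))) ∸ 1 ≡⟨ cong (λ c → (c + count (λ i → not (i == w))) ∸ 1) (count-singleton w) ⟩
      count (λ i → not (i == w))                       ∎)
      where open ≡-Reasoning

    class-size : ∀ t → count (λ i → class i == t) ≡ blockSize 1 (N ∸ 1) 0 0 t
    class-size 0F = trans (sum-cong-≗ {N} pointwise) (count-singleton w)
      where
      pointwise : ∀ i → [ class i == 0F ] ≡ [ i == w ]
      pointwise i with i == w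
      ... | true  = refl
      ... | false = refl
    class-size 1F = trans (sum-cong-≗ {N} pointwise) count-others
      where
      pointwise : ∀ i → [ class i == 1F ] ≡ [ not (i == w) ]
      pointwise i with i == w
      ... | true  = refl
      ... | false = refl
    class-size 2F = trans (sum-cong-≗ {N} pointwise) (trans (sum-const N 0) (*-zeroʳ N))
      where
      pointwise : ∀ i → [ class i == 2F ] ≡ 0
      pointwise i with i == w
      ... | true  = refl
      ... | false = refl
    class-size 3F = trans (sum-cong-≗ {N} pointwise) (trans (sum-const N 0) (*-zeroʳ N))
      where
      pointwise : ∀ i → [ class i == 3F ] ≡ 0
      pointwise i with i == w
      ... | true  = refl
      ... | false = refl

    star-≅ : G ≅ star (N ∸ 1)
    star-≅ = blowUp-≅ (blowUp-of class adj≡pattern class-size) (star-blowUp (N ∸ 1))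

  module TwoCentresClasses {linked ℓ} (S : TwoCentres linked ℓ) where
    open TwoCentres S

    class : Fin N → Fin 4
    class i = if i == c₁ then 0F else if i == c₂ then 2F else if A c₁ i then 1F else 3F

    leaf-neighbour : ∀ {c i j} → i ≢ c₁ → i ≢ c₂ → A c i ≡ true → A i j ≡ true → j ≡ c
    leaf-neighbour i≢c₁ i≢c₂ ci ij = only-neighbour (leaf _ i≢c₁ i≢c₂) (adj-flip ci) ij

    not-both : ∀ {i} → i ≢ c₁ → i ≢ c₂ → A c₁ i ≡ true → A c₂ i ≡ false
    not-both i≢c₁ i≢c₂ c₁i = ¬true⇒false (λ c₂i → c₁≢c₂ (sym (leaf-neighbour i≢c₁ i≢c₂ c₁i (adj-flip c₂i))))

    data Role (i : Fin N) : Set where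
      centre₁ : i ≡ c₁ → Role i
      centre₂ : i ≡ c₂ → Role i
      leaf₁   : i ≢ c₁ → i ≢ c₂ → A c₁ i ≡ true → Role i
      leaf₂   : i ≢ c₁ → i ≢ c₂ → A c₁ i ≡ false → A c₂ i ≡ true → Role i

    role : ∀ i → Role i
    role i with i ≟ c₁ | i ≟ c₂ | A c₁ i in c₁i | cover i
    ... | yes i≡c₁ | _        | _     | _ = centre₁ i≡c₁
    ... | no _     | yes i≡c₂ | _     | _ = centre₂ i≡c₂
    ... | no i≢c₁  | no i≢c₂  | true  | _ = leaf₁ i≢c₁ i≢c₂ c₁i
    ... | no i≢c₁  | no i≢c₂  | false | inj₁ i≡c₁ = ⊥-elim (i≢c₁ i≡c₁)
    ... | no i≢c₁  | no i≢c₂  | false | inj₂ (inj₁ i≡c₂) = ⊥-elim (i≢c₂ i≡c₂)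
    ... | no i≢c₁  | no i≢c₂  | false | inj₂ (inj₂ (inj₁ c₁i′)) = ⊥-elim (false≢true c₁i′)
    ... | no i≢c₁  | no i≢c₂  | false | inj₂ (inj₂ (inj₂ c₂i)) = leaf₂ i≢c₁ i≢c₂ c₁i c₂i

    class-centre₁ : class c₁ ≡ 0F
    class-centre₁ rewrite ==-refl c₁ = refl

    class-centre₂ : class c₂ ≡ 2F
    class-centre₂ rewrite ≢⇒==false (c₁≢c₂ ∘ sym) | ==-refl c₂ = refl

    class-leaf₁ : ∀ {i} → i ≢ c₁ → i ≢ c₂ → A c₁ i ≡ true → class i ≡ 1F
    class-leaf₁ i≢c₁ i≢c₂ c₁i rewrite ≢⇒==false i≢c₁ | ≢⇒==false i≢c₂ | c₁i = refl

    class-leaf₂ : ∀ {i} → i ≢ c₁ → i ≢ c₂ → A c₁ i ≡ false → class i ≡ 3F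
    class-leaf₂ i≢c₁ i≢c₂ c₁i rewrite ≢⇒==false i≢c₁ | ≢⇒==false i≢c₂ | c₁i = refl

    class-role : ∀ {i} → Role i → ∃ λ t → class i ≡ t
    class-role (centre₁ refl)       = 0F , class-centre₁
    class-role (centre₂ refl)       = 2F , class-centre₂
    class-role (leaf₁ i≢c₁ i≢c₂ c₁i)   = 1F , class-leaf₁ i≢c₁ i≢c₂ c₁i
    class-role (leaf₂ i≢c₁ i≢c₂ c₁i _) = 3F , class-leaf₂ i≢c₁ i≢c₂ c₁i

    R : Fin 4 → Fin 4 → Bool
    R = undirected (twoCentresArc linked)

    not-leaf-neighbour : ∀ {c i j} → i ≢ c₁ → i ≢ c₂ → A c i ≡ true → j ≢ c → A i j ≡ false
    not-leaf-neighbour i≢c₁ i≢c₂ ci j≢c = ¬true⇒false (j≢c ∘ leaf-neighbour i≢c₁ i≢c₂ ci)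

    adj-roles : ∀ {i j} (ρ : Role i) (σ : Role j) → A i j ≡ R (proj₁ (class-role ρ)) (proj₁ (class-role σ))
    adj-roles (centre₁ refl) (centre₁ refl) = irrefl G c₁
    adj-roles (centre₁ refl) (centre₂ refl) = trans centres (sym (∨-identityʳ linked))
    adj-roles (centre₁ refl) (leaf₁ _ _ c₁j) = c₁j
    adj-roles (centre₁ refl) (leaf₂ _ _ c₁j _) = c₁j
    adj-roles (centre₂ refl) (centre₁ refl) = adj-flip centres
    adj-roles (centre₂ refl) (centre₂ refl) = irrefl G c₂
    adj-roles (centre₂ refl) (leaf₁ j≢c₁ j≢c₂ c₁j) = not-both j≢c₁ j≢c₂ c₁j
    adj-roles (centre₂ refl) (leaf₂ _ _ _ c₂j) = c₂j
    adj-roles (leaf₁ _ _ c₁i) (centre₁ refl) = adj-flip c₁i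
    adj-roles (leaf₁ i≢c₁ i≢c₂ c₁i) (centre₂ refl) = adj-flip (not-both i≢c₁ i≢c₂ c₁i)
    adj-roles (leaf₁ i≢c₁ i≢c₂ c₁i) (leaf₁ j≢c₁ _ _) = not-leaf-neighbour i≢c₁ i≢c₂ c₁i j≢c₁
    adj-roles (leaf₁ i≢c₁ i≢c₂ c₁i) (leaf₂ j≢c₁ _ _ _) = not-leaf-neighbour i≢c₁ i≢c₂ c₁i j≢c₁
    adj-roles (leaf₂ _ _ c₁i _) (centre₁ refl) = adj-flip c₁i
    adj-roles (leaf₂ _ _ _ c₂i) (centre₂ refl) = adj-flip c₂i
    adj-roles (leaf₂ i≢c₁ i≢c₂ _ c₂i) (leaf₁ _ j≢c₂ _) = not-leaf-neighbour i≢c₁ i≢c₂ c₂i j≢c₂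
    adj-roles (leaf₂ i≢c₁ i≢c₂ _ c₂i) (leaf₂ _ j≢c₂ _ _) = not-leaf-neighbour i≢c₁ i≢c₂ c₂i j≢c₂

    adj≡pattern : ∀ i j → A i j ≡ R (class i) (class j)
    adj≡pattern i j = trans (adj-roles (role i) (role j)) (sym (cong₂ R (proj₂ (class-role (role i))) (proj₂ (class-role (role j)))))

    member : Fin 4 → Fin N → Bool
    member 0F i = i == c₁
    member 1F i = A c₁ i ∧ not (i == c₂)
    member 2F i = i == c₂
    member 3F i = A c₂ i ∧ not (i == c₁)

    member-role : ∀ {i} (ρ : Role i) t → member t i ≡ (proj₁ (class-role ρ) == t)
    member-role (centre₁ refl) 0F = ==-refl c₁
    member-role (centre₁ refl) 1F rewrite irrefl G c₁ = refl
    member-role (centre₁ refl) 2F = ≢⇒==false c₁≢c₂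
    member-role (centre₁ refl) 3F rewrite ==-refl c₁ = ∧-zeroʳ _
    member-role (centre₂ refl) 0F = ≢⇒==false (c₁≢c₂ ∘ sym)
    member-role (centre₂ refl) 1F rewrite ==-refl c₂ = ∧-zeroʳ _
    member-role (centre₂ refl) 2F = ==-refl c₂
    member-role (centre₂ refl) 3F rewrite irrefl G c₂ = refl
    member-role (leaf₁ i≢c₁ i≢c₂ c₁i) 0F = ≢⇒==false i≢c₁
    member-role (leaf₁ i≢c₁ i≢c₂ c₁i) 1F rewrite c₁i | ≢⇒==false i≢c₂ = refl
    member-role (leaf₁ i≢c₁ i≢c₂ c₁i) 2F = ≢⇒==false i≢c₂
    member-role (leaf₁ i≢c₁ i≢c₂ c₁i) 3F rewrite not-both i≢c₁ i≢c₂ c₁i = refl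
    member-role (leaf₂ i≢c₁ i≢c₂ c₁i c₂i) 0F = ≢⇒==false i≢c₁
    member-role (leaf₂ i≢c₁ i≢c₂ c₁i c₂i) 1F rewrite c₁i = refl
    member-role (leaf₂ i≢c₁ i≢c₂ c₁i c₂i) 2F = ≢⇒==false i≢c₂
    member-role (leaf₂ i≢c₁ i≢c₂ c₁i c₂i) 3F rewrite c₂i | ≢⇒==false i≢c₁ = refl

    count-member : ∀ t → count (member t) ≡ blockSize 1 ℓ 1 ℓ t
    count-member 0F = count-singleton c₁
    count-member 1F = leaves₁
    count-member 2F = count-singleton c₂
    count-member 3F = leaves₂

    class-size : ∀ t → count (λ i → class i == t) ≡ blockSize 1 ℓ 1 ℓ t
    class-size t = trans (sum-cong-≗ {N} λ i → cong [_] (trans (cong (_== t) (proj₂ (class-role (role i)))) (sym (member-role (role i) t))))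
                         (count-member t)

  twoCentres-twoStars-≅ : ∀ {k} → TwoCentres false k → G ≅ twoStars k
  twoCentres-twoStars-≅ {k} S = blowUp-≅ (blowUp-of class adj≡pattern class-size) (twoStars-blowUp k)
    where open TwoCentresClasses S

  -- H4tree lists u₁, the leaves u₂ … u_k of v_k, the leaves v₁ … v_{k-1} of u₁ and finally v_k.
  doubleStarPlace : Fin 4 → Fin 4
  doubleStarPlace 0F = 0F
  doubleStarPlace 1F = 2F
  doubleStarPlace 2F = 3F
  doubleStarPlace 3F = 1F

  doubleStarPlace⁻¹ : Fin 4 → Fin 4
  doubleStarPlace⁻¹ 0F = 0F
  doubleStarPlace⁻¹ 1F = 3F
  doubleStarPlace⁻¹ 2F = 1F
  doubleStarPlace⁻¹ 3F = 2F

  twoCentres-doubleStar-≅ : ∀ {b} → TwoCentres true b → G ≅ H4tree (suc b)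
  twoCentres-doubleStar-≅ {b} S = blowUp-≅ (blowUp-of (doubleStarPlace ∘ class) adj≡placed sizes) (doubleStar-blowUp b)
    where
    open TwoCentresClasses S
    placed-pattern : ∀ s t → undirected (twoCentresArc true) s t ≡ undirected doubleStarArc (doubleStarPlace s) (doubleStarPlace t)
    placed-pattern = from-yes (all? λ s → all? λ t → undirected (twoCentresArc true) s t Bool.≟ undirected doubleStarArc (doubleStarPlace s) (doubleStarPlace t))
    placed-== : ∀ s t → (doubleStarPlace s == t) ≡ (s == doubleStarPlace⁻¹ t)
    placed-== = from-yes (all? λ s → all? λ t → (doubleStarPlace s == t) Bool.≟ (s == doubleStarPlace⁻¹ t))
    adj≡placed : ∀ i j → A i j ≡ undirected doubleStarArc (doubleStarPlace (class i)) (doubleStarPlace (class j))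
    adj≡placed i j = trans (adj≡pattern i j) (placed-pattern (class i) (class j))
    placed-size : ∀ t → blockSize 1 b 1 b (doubleStarPlace⁻¹ t) ≡ blockSize 1 b b 1 t
    placed-size 0F = refl
    placed-size 1F = refl
    placed-size 2F = refl
    placed-size 3F = refl
    sizes : ∀ t → count (λ i → doubleStarPlace (class i) == t) ≡ blockSize 1 b b 1 t
    sizes t = trans (sum-cong-≗ {N} (λ i → cong [_] (placed-== (class i) t))) (trans (class-size (doubleStarPlace⁻¹ t)) (placed-size t))

  K22Shape-≅ : K22Shape → G ≅ K22
  K22Shape-≅ S = record { bij = Perm.permutation class corner class-corner corner-class ; preserve = preserve }
    where
    open K22Shape S
    class : Fin N → Fin 4
    class i = proj₁ (corner-onto i)
    corner-class : ∀ i → corner (class i) ≡ i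
    corner-class i = proj₂ (corner-onto i)
    class-corner : ∀ t → class (corner t) ≡ t
    class-corner t = corner-injective (corner-class (corner t))
    preserve : ∀ i j → A i j ≡ adj K22 (class i) (class j)
    preserve i j = trans (sym (cong₂ A (corner-class i) (corner-class j))) (corner-adj (class i) (class j))

  matching-≅ : (∀ i → d i ≡ 1) → G ≅ H1 (numEdges G)
  matching-≅ d≡1 = perfectMatching-≅ vertices matching (H1-perfectMatching (numEdges G))
    where
    partner : Fin N → Fin N
    partner i = proj₁ (noIsolated i)
    matching : PerfectMatching G
    matching = record
      { partner = partner
      ; adj-partner = λ i j → bool-ext
          (λ ij → subst (λ x → (x == partner i) ≡ true) (sym (only-neighbour (d≡1 i) (proj₂ (noIsolated i)) ij)) (==-refl _))
          (λ j≡ → subst (λ x → A i x ≡ true) (sym (==⇒≡ j≡)) (proj₂ (noIsolated i))) }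
    vertices : N ≡ 2 * numEdges G
    vertices = sym (trans (handshake G) (trans (sum-cong-≗ {N} d≡1) (count-true N)))

  edge-avoiding? : ∀ w → Dec (EdgeAvoiding w)
  edge-avoiding? w = any? λ x → any? λ y → (A x y Bool.≟ true) ×-dec (¬? (x ≟ w) ×-dec ¬? (y ≟ w))

  non-star⇒edge-avoiding : ¬ IsStar G → ∀ w → EdgeAvoiding w
  non-star⇒edge-avoiding non-star w = decidable-stable (edge-avoiding? w) (non-star ∘ is-star)
    where
    1≤N∸1 : 1 ≤ N ∸ 1
    1≤N∸1 = ∸-monoˡ-≤ 1 (subst (2 ≤_) (count-true N)
              (2≤count (λ _ → true) {w} {proj₁ (noIsolated w)} refl refl (adj⇒≢ (proj₂ (noIsolated w)))))
    is-star : ¬ EdgeAvoiding w → IsStar G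
    is-star no-avoiding = N ∸ 1 , 1≤N∸1 , NoEdgeAvoiding.star-≅ w no-avoiding

  minS1-bound : Fin N → ¬ IsStar G → Bound (minS1 G)
  minS1-bound a₀ non-star = at (minS1+2-attained G (proj₂ (noIsolated a₀)))
    where
    at : (∃ λ u → ∃ λ v → A u v ≡ true × minS1 G + 2 ≡ d u + d v) → Bound (minS1 G)
    at (u , v , uv , minS1+2≡) =
      subst Bound (sym minS1≡) (bound (pred (d u)) (pred (d v)) uv minimal (non-star⇒edge-avoiding non-star) (d≡suc-pred u) (d≡suc-pred v))
      where
      minimal : DegreeSumMinimal u v
      minimal {x} {y} xy = subst (_≤ d x + d y) minS1+2≡ (minS1+2≤ G xy)
      minS1≡ : minS1 G ≡ pred (d u) + pred (d v)
      minS1≡ = +-cancelʳ-≡ 2 _ _ (trans minS1+2≡ (trans (cong₂ _+_ (d≡suc-pred u) (d≡suc-pred v)) (lemma (pred (d u)) (pred (d v)))))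
        where
        lemma : ∀ p q → suc p + suc q ≡ p + q + 2
        lemma = solve-∀

  shape⇒conclusion : Shape → Conclusion G
  shape⇒conclusion (inj₁ S) = inj₁ (K22Shape-≅ S)
  shape⇒conclusion (inj₂ (inj₁ (d≡1 , 3≤N))) = inj₂ (inj₁ (numEdges G , 2≤m , matching-≅ d≡1))
    where
    2≤m : 2 ≤ numEdges G
    2≤m = 3≤2*m⇒2≤m (subst (3 ≤_) (trans (sym (count-true N)) (trans (sym (sum-cong-≗ {N} d≡1)) (sym (handshake G)))) 3≤N)
  shape⇒conclusion (inj₂ (inj₂ (inj₁ (k , 1≤k , S)))) =
    inj₂ (inj₂ (inj₁ (2 * k , *-monoʳ-≤ 2 1≤k , divides k (*-comm 2 k) ,
                      subst (λ q → G ≅ twoStars q) (sym (2*k/2≡k k)) (twoCentres-twoStars-≅ S))))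
  shape⇒conclusion (inj₂ (inj₂ (inj₂ (b , 1≤b , S)))) =
    inj₂ (inj₂ (inj₂ (inj₂ (suc (2 * b) , s≤s (*-monoʳ-≤ 2 1≤b) , ¬2∣1+2*b b ,
                            subst (λ q → G ≅ H4tree q) (sym ([1+2*b+1]/2≡1+b b)) (twoCentres-doubleStar-≅ S)))))

K22-extremal : HasEdge K22 × Extremal K22
K22-extremal = (0F , 2F , refl) , refl

twoStars-extremal-≅ : ∀ {G} m → 2 ≤ m → 2 ∣ m → G ≅ twoStars (m / 2) → Extremal G
twoStars-extremal-≅ _ () (divides zero refl) _
twoStars-extremal-≅ {G} _ _ (divides (suc k) refl) G≅ =
  ≅-extremal (subst (λ q → G ≅ twoStars q) (m*n/n≡m (suc k) 2) G≅) (twoStars-extremal k)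

doubleStar-extremal-≅ : ∀ {G} k → 2 ≤ k → G ≅ H4tree k → Extremal G
doubleStar-extremal-≅ (suc zero) (s≤s ()) _
doubleStar-extremal-≅ (suc (suc b)) _ G≅ = ≅-extremal G≅ (doubleStar-extremal (suc b) (s≤s z≤n))

conclusion⇒extremal : ∀ {G} → Conclusion G → Extremal G
conclusion⇒extremal (inj₁ G≅K22) = ≅-extremal G≅K22 K22-extremal
conclusion⇒extremal (inj₂ (inj₁ (m , 2≤m , G≅H1))) =
  ≅-extremal G≅H1 (perfectMatching-extremal (H1-perfectMatching m) (fromℕ< (≤-trans (s≤s z≤n) (≤-trans 2≤m (m≤m+n m (m + 0))))))
conclusion⇒extremal (inj₂ (inj₂ (inj₁ (m , 2≤m , 2∣m , G≅H2))))          = twoStars-extremal-≅ m 2≤m 2∣m G≅H2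
conclusion⇒extremal (inj₂ (inj₂ (inj₂ (inj₁ (m , 2≤m , 2∣m , G≅H3)))))   = twoStars-extremal-≅ m 2≤m 2∣m G≅H3
conclusion⇒extremal (inj₂ (inj₂ (inj₂ (inj₂ (m , 3≤m , _ , G≅H4))))) =
  doubleStar-extremal-≅ ((m + 1) / 2) (/-monoˡ-≤ 2 (+-monoˡ-≤ 1 3≤m)) G≅H4

theorem1p6 : (G : Graph) → 0 < numVertices G → IsBipartite G → NoIsolated G → ¬ IsStar G →
    (2 * minS1 G + numVertices G ≤ 2 * numEdges G)
    × ((2 * minS1 G + numVertices G ≡ 2 * numEdges G)
       ⇔ ((G ≅ K22)
          ⊎ (∃ λ m → (2 ≤ m) × (G ≅ H1 m))
          ⊎ (∃ λ m → (2 ≤ m) × (2 ∣ m) × (G ≅ H2 m))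
          ⊎ (∃ λ m → (2 ≤ m) × (2 ∣ m) × (G ≅ H3 m))
          ⊎ (∃ λ m → (3 ≤ m) × (¬ (2 ∣ m)) × (G ≅ H4 m))))
theorem1p6 G 0<N bipartite noIsolated non-star =
  subst (2 * minS1 G + N ≤_) (sym (handshake G)) (proj₁ bound-at-min) ,
  mk⇔ (λ tight → shape⇒conclusion (proj₂ bound-at-min (trans tight (handshake G)))) conclusion⇒extremal
  where
  open BipartiteWithoutIsolated G bipartite noIsolated
  bound-at-min : Bound (minS1 G)
  bound-at-min = minS1-bound (fromℕ< 0<N) non-star
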